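{- For every integer $k\geq 1$, $$\sum_{\iota\in\mathcal{I}_{2k}(123)} q^{\mathrm{coinv}(\iota)} = \sum_{j=1}^k B_{2j+1,k-j}(q^2) + \sum_{j=1}^k q^{2j-1} A_{2j,k-j}(q^2).$$
   Context: A permutation $\sigma$ of $[n]$ (one-line notation) contains a pattern $\pi\in\mathfrak{S}_k$ if some subsequence $\sigma(m_1)\cdots\sigma(m_k)$ with $m_1<\dots<m_k$ is in the same relative order as $\pi$; otherwise it avoids $\pi$. $\mathcal{I}_n(\pi)$ is the set of involutions ($\iota^2=\mathrm{id}$) of $[n]$ avoiding $\pi$. $\mathrm{coinv}(\sigma)$ is the number of pairs $i<j$ with $\sigma(i)<\sigma(j)$. For positive integers $m$ and $\ell\ge 0$, $A_{m,\ell}$ is the set of sequences $(a_1,\dots,a_\ell)$ of positive integers such that: (1) $a_1\le m$; (2) if $a_1,\dots,a_i$ are all equal to $1$ then $a_{i+1}\le m+i$; (3) if $a_i\ne 1$ and $a_{i+1},\dots,a_{i+r}$ are all equal to $1$ (for some $r\ge 0$) then $a_{i+r+1}\le a_i+r$. (For $\ell=0$, $A_{m,0}$ consists of the empty sequence.) Let $B_{m,\ell}=\{(a_1,\dots,a_\ell)\in A_{m,\ell}: a_1\neq 1\}$. Define $A_{m,\ell}(q)=\sum_{(a_1,\dots,a_\ell)\in A_{m,\ell}} q^{a_1+\dots+a_\ell-\ell}$ and $B_{m,\ell}(q)$ analogously over $B_{m,\ell}$. -}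

module Defs where

open import Data.Nat using (ℕ; zero; suc; _+_; _*_; _∸_; _≤_; _<_; _≤?_; _<?_)
open import Data.Nat.Properties using (_≟_)
open import Data.Fin as F using (Fin; toℕ)
open import Data.Fin.Properties as FP using (all?; any?)
open import Data.List using (List; []; _∷_; map; concatMap; upTo; filter; length; allFin)
open import Data.Nat.ListAction using (sum)
open import Data.Product using (_×_; _,_; ∃; ∃-syntax)
open import Relation.Binary.PropositionalEquality using (_≡_)
open import Relation.Nullary using (Dec; ¬_; ¬?; map′)
open import Relation.Nullary.Decidable using (_×-dec_; _→-dec_)

extend : ∀ {A : Set} {ℓ : ℕ} → A → (Fin ℓ → A) → Fin (suc ℓ) → A
extend a f F.zero    = a
extend a f (F.suc i) = f i

allFuns : ∀ {A : Set} → List A → (ℓ : ℕ) → List (Fin ℓ → A)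
allFuns xs zero    = (λ ()) ∷ []
allFuns xs (suc ℓ) = concatMap (λ a → map (extend a) (allFuns xs ℓ)) xs

-- Permutations in one-line notation: σ : Fin n → Fin n, σ(i) = i-th letter
-- (positions and values 0-based; [n] = {0,…,n-1} up to the shift by one).

IsInvolution : ∀ {n} → (Fin n → Fin n) → Set
IsInvolution {n} σ = ∀ (i : Fin n) → σ (σ i) ≡ i

Contains123 : ∀ {n} → (Fin n → Fin n) → Set
Contains123 {n} σ =
  ∃[ i ] ∃[ j ] ∃[ l ] ((i F.< j) × (j F.< l) × (σ i F.< σ j) × (σ j F.< σ l))

Avoids123 : ∀ {n} → (Fin n → Fin n) → Set
Avoids123 σ = ¬ Contains123 σ

coinv : ∀ {n} → (Fin n → Fin n) → ℕ
coinv {n} σ =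
  length (filter (λ p → (proj₁′ p F.<? proj₂′ p) ×-dec (σ (proj₁′ p) F.<? σ (proj₂′ p)))
                 (concatMap (λ i → map (λ j → (i , j)) (allFin n)) (allFin n)))
  where
  proj₁′ : Fin n × Fin n → Fin n
  proj₁′ (i , _) = i
  proj₂′ : Fin n × Fin n → Fin n
  proj₂′ (_ , j) = j

inv? : ∀ {n} (σ : Fin n → Fin n) → Dec (IsInvolution σ)
inv? σ = all? (λ i → σ (σ i) FP.≟ i)

contains123? : ∀ {n} (σ : Fin n → Fin n) → Dec (Contains123 σ)
contains123? σ = any? λ i → any? λ j → any? λ l →
  (i F.<? j) ×-dec (j F.<? l) ×-dec (σ i F.<? σ j) ×-dec (σ j F.<? σ l)

involutions123 : (n : ℕ) → List (Fin n → Fin n)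
involutions123 n =
  filter (λ σ → inv? σ ×-dec ¬? (contains123? σ)) (allFuns (allFin n) n)

-- Polynomials in q with ℕ coefficients, as coefficient functions
-- (p d = coefficient of q^d).

Poly : Set
Poly = ℕ → ℕ

genPoly : ∀ {X : Set} → List X → (X → ℕ) → Poly
genPoly xs w d = length (filter (λ x → w x ≟ d) xs)

-- p(q) ↦ p(q²)
substSq : Poly → Poly
substSq p d = go d
  where
  go : ℕ → ℕ
  go zero          = p 0
  go (suc zero)    = 0
  go (suc (suc e)) = substSq (λ t → p (suc t)) e

-- p(q) ↦ q^e · p(q)
shiftBy : ℕ → Poly → Poly
shiftBy zero    p d       = p d
shiftBy (suc e) p zero    = 0
shiftBy (suc e) p (suc d) = shiftBy e p d

_⊕_ : Poly → Poly → Poly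
(p ⊕ r) d = p d + r d

-- Σ_{j=1}^k f j
sumPoly : (ℕ → Poly) → ℕ → Poly
sumPoly f k d = sum (map (λ j → f (suc j) d) (upTo k))

-- The sequence sets A_{m,ℓ} and B_{m,ℓ}.
-- A sequence (a_1,…,a_ℓ) is a : Fin ℓ → ℕ with a_{p+1} = a p (0-based).

record InA (m ℓ : ℕ) (a : Fin ℓ → ℕ) : Set where
  field
    positive : ∀ (p : Fin ℓ) → 1 ≤ a p
    cond1    : ∀ (p : Fin ℓ) → toℕ p ≡ 0 → a p ≤ m
    -- (2) if a_1 = … = a_i = 1 then a_{i+1} ≤ m + i   (here p = i)
    cond2    : ∀ (p : Fin ℓ) →
               (∀ (t : Fin ℓ) → toℕ t < toℕ p → a t ≡ 1) → a p ≤ m + toℕ p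
    -- (3) if a_i ≠ 1 and a_{i+1} = … = a_{i+r} = 1 then a_{i+r+1} ≤ a_i + r
    --     (positions i < p with p = i + r + 1, so r = p - i - 1)
    cond3    : ∀ (i p : Fin ℓ) → toℕ i < toℕ p → ¬ (a i ≡ 1) →
               (∀ (t : Fin ℓ) → toℕ i < toℕ t → toℕ t < toℕ p → a t ≡ 1) →
               a p ≤ a i + (toℕ p ∸ toℕ i ∸ 1)

InB : (m ℓ : ℕ) → (Fin ℓ → ℕ) → Set
InB m ℓ a = InA m ℓ a × (∀ (p : Fin ℓ) → toℕ p ≡ 0 → ¬ (a p ≡ 1))

inA? : ∀ m ℓ (a : Fin ℓ → ℕ) → Dec (InA m ℓ a)
inA? m ℓ a =
      map′ (λ { (x , y , z , w) → record { positive = x ; cond1 = y ; cond2 = z ; cond3 = w } })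
           (λ r → InA.positive r , InA.cond1 r , InA.cond2 r , InA.cond3 r)
           ( all? (λ p → 1 ≤? a p)
           ×-dec all? (λ p → (toℕ p ≟ 0) →-dec (a p ≤? m))
           ×-dec all? (λ p → all? (λ t → (toℕ t <? toℕ p) →-dec (a t ≟ 1)) →-dec (a p ≤? m + toℕ p))
           ×-dec all? (λ i → all? (λ p → (toℕ i <? toℕ p) →-dec ¬? (a i ≟ 1) →-dec
                    all? (λ t → (toℕ i <? toℕ t) →-dec (toℕ t <? toℕ p) →-dec (a t ≟ 1)) →-dec
                    (a p ≤? a i + (toℕ p ∸ toℕ i ∸ 1)))))

inB? : ∀ m ℓ (a : Fin ℓ → ℕ) → Dec (InB m ℓ a)
inB? m ℓ a = inA? m ℓ a ×-dec all? (λ p → (toℕ p ≟ 0) →-dec ¬? (a p ≟ 1))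

-- Every element of A_{m,ℓ} has all entries ≤ m + ℓ (by (1)–(3)), so the
-- candidates with entries in {0,…,m+ℓ} contain every member of A_{m,ℓ}.
candidates : (m ℓ : ℕ) → List (Fin ℓ → ℕ)
candidates m ℓ = allFuns (upTo (suc (m + ℓ))) ℓ

Aset : (m ℓ : ℕ) → List (Fin ℓ → ℕ)
Aset m ℓ = filter (inA? m ℓ) (candidates m ℓ)

Bset : (m ℓ : ℕ) → List (Fin ℓ → ℕ)
Bset m ℓ = filter (inB? m ℓ) (candidates m ℓ)

weight : ∀ {ℓ} → (Fin ℓ → ℕ) → ℕ
weight {ℓ} a = sum (map a (allFin ℓ)) ∸ ℓ

Apoly : ℕ → ℕ → Poly
Apoly m ℓ = genPoly (Aset m ℓ) weight

Bpoly : ℕ → ℕ → Poly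
Bpoly m ℓ = genPoly (Bset m ℓ) weight

invPoly : ℕ → Poly
invPoly n = genPoly (involutions123 n) coinv

-- Proof by a coinv-preserving bijection with codes.  If σ ∈ I_{n+2}(123) has
-- σ(0) = s+1, removing the 2-cycle (0 s+1) leaves τ ∈ I_n(123) decreasing from
-- position s on, and coinv σ = coinv τ + 2(n-s); if σ(0) = 0, σ is 0 ⊕ reversal.
-- Peeling off cycles encodes σ by a height j, a base involution of [2j] (the
-- reversal, or 0 ⊕ reversal) and the parameters r = n-s+1 of the removed cycles.
-- A parameter r is possible iff r ≤ m, where m - 1 is the length of the final
-- decreasing run, which then becomes nextRun m r: this is the recursion of
-- A_{2j,ℓ}, and of B_{2j+1,ℓ} for the reversal base (a₁ ≠ 1 removes the one
-- ambiguity, the reversal growing into a larger reversal).  Both sides of the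
-- identity thus count one list of codes by one weight.
module Submission where

open import Defs
open import Data.Nat using (ℕ; suc; _+_; _*_; _∸_; _≤_)
open import Relation.Binary.PropositionalEquality using (_≡_)

module Counting where

  open import Data.Nat using (ℕ; zero; suc; _+_; _≤_; z≤n; s≤s; _≟_)
  open import Data.Nat.Properties using (+-suc; ≤-antisym; module ≤-Reasoning)
  open import Data.Fin as Fin using (Fin)
  open import Data.List using (List; []; _∷_; _++_; map; concatMap; length; filter)
  open import Data.List.Properties using (length-++; filter-++; filter-reject)
  open import Data.Nat.ListAction using (sum)
  open import Data.List.Relation.Unary.Any using (here; there)
  import Data.List.Relation.Unary.Any
  open import Data.List.Relation.Unary.All using (All; []; _∷_)
  import Data.List.Relation.Unary.All as All
  import Data.List.Relation.Unary.All.Properties as All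
  import Data.List.Relation.Unary.AllPairs as AllPairs
  open import Data.List.Relation.Unary.AllPairs using ([]; _∷_)
  import Data.List.Relation.Unary.AllPairs.Properties as AllPairsₚ
  import Data.List.Relation.Unary.Unique.Propositional as Unique≡
  import Data.List.Membership.Propositional as Mem≡
  import Data.List.Membership.Setoid as SetoidMembership
  open import Data.List.Membership.Setoid.Properties
    using (∈-∃++; ∈-resp-≋; ∈-++⁻; ∈-++⁺ˡ; ∈-++⁺ʳ; ∈-filter⁺; ∈-filter⁻; ∈-map⁺; ∈-map⁻; ∈-resp-≈; ∈-concatMap⁺)
  import Data.List.Relation.Unary.Unique.Setoid as SetoidUnique
  import Data.List.Relation.Unary.Unique.Setoid.Properties as SetoidUniqueₚ
  open import Data.List.Relation.Binary.Equality.Setoid using (≋-length)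
  open import Data.Product using (Σ; _×_; _,_)
  open import Data.Sum using (inj₁; inj₂)
  open import Data.Empty using (⊥-elim)
  open import Level using (0ℓ)
  open import Relation.Binary using (Setoid)
  open import Relation.Binary.PropositionalEquality
    using (_≡_; _≢_; _≗_; refl; sym; trans; cong; _→-setoid_) renaming (setoid to ≡-setoid)
  open import Relation.Nullary using (¬_; yes; no)
  open import Relation.Unary using (Decidable)

  count : ∀ {X : Set} {P : X → Set} → Decidable P → List X → ℕ
  count P? xs = length (filter P? xs)

  module _ {X : Set} {P : X → Set} (P? : Decidable P) where

    count-++ : ∀ xs ys → count P? (xs ++ ys) ≡ count P? xs + count P? ys
    count-++ xs ys = trans (cong length (filter-++ P? xs ys)) (length-++ (filter P? xs))

    count-concatMap : ∀ {Y : Set} (f : Y → List X) ys →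
                      count P? (concatMap f ys) ≡ sum (map (λ y → count P? (f y)) ys)
    count-concatMap f []       = refl
    count-concatMap f (y ∷ ys) =
      trans (count-++ (f y) (concatMap f ys)) (cong (count P? (f y) +_) (count-concatMap f ys))

    count-map : ∀ {Y : Set} (f : Y → X) ys → count P? (map f ys) ≡ count (λ y → P? (f y)) ys
    count-map f [] = refl
    count-map f (y ∷ ys) with P? (f y)
    ... | yes _ = cong suc (count-map f ys)
    ... | no _ = count-map f ys

  count-cong : ∀ {X : Set} {P Q : X → Set} (P? : Decidable P) (Q? : Decidable Q) xs →
               All (λ x → (P x → Q x) × (Q x → P x)) xs → count P? xs ≡ count Q? xs
  count-cong P? Q? []       []                 = refl
  count-cong P? Q? (x ∷ xs) ((p⇒q , q⇒p) ∷ eq) with P? x | Q? x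
  ... | yes _  | yes _  = cong suc (count-cong P? Q? xs eq)
  ... | yes p  | no ¬q  = ⊥-elim (¬q (p⇒q p))
  ... | no ¬p  | yes q  = ⊥-elim (¬p (q⇒p q))
  ... | no _   | no _   = count-cong P? Q? xs eq

  count-statistic : ∀ {X : Set} (f g : X → ℕ) d xs → (∀ {x} → x Mem≡.∈ xs → f x ≡ g x) →
                    count (λ x → f x ≟ d) xs ≡ count (λ x → g x ≟ d) xs
  count-statistic f g d xs f≡g =
    count-cong _ _ xs (All.tabulate λ x∈ → (λ fx≡d → trans (sym (f≡g x∈)) fx≡d) , (λ gx≡d → trans (f≡g x∈) gx≡d))

  count-none : ∀ {X : Set} {P : X → Set} (P? : Decidable P) xs → (∀ x → ¬ P x) → count P? xs ≡ 0
  count-none P? []       never = refl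
  count-none P? (x ∷ xs) never = trans (cong length (filter-reject P? (never x))) (count-none P? xs never)

  module DoubleCounting (S : Setoid 0ℓ 0ℓ) where
    open Setoid S renaming (Carrier to X; refl to ≈-refl; sym to ≈-sym; trans to ≈-trans)
    open SetoidMembership S using (_∈_)
    open SetoidUnique S using (Unique)

    unique-length-≤ : ∀ xs ys → Unique xs → (∀ {z} → z ∈ xs → z ∈ ys) → length xs ≤ length ys
    unique-length-≤ []       ys _              _    = z≤n
    unique-length-≤ (x ∷ xs) ys (x≉xs ∷ uxs) xs⊆ys
      with us , vs , w , x≈w , ys≋ ← ∈-∃++ S (xs⊆ys (here ≈-refl)) = begin
        suc (length xs)          ≤⟨ s≤s (unique-length-≤ xs (us ++ vs) uxs xs⊆us++vs) ⟩
        suc (length (us ++ vs))  ≡⟨ cong suc (length-++ us) ⟩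
        suc (length us + length vs) ≡⟨ sym (+-suc (length us) (length vs)) ⟩
        length us + length (w ∷ vs) ≡⟨ sym (length-++ us) ⟩
        length (us ++ w ∷ vs)    ≡⟨ sym (≋-length S ys≋) ⟩
        length ys ∎
      where
      open ≤-Reasoning
      distinct : ∀ {z} zs → All (λ y → ¬ x ≈ y) zs → z ∈ zs → ¬ z ≈ w
      distinct (y ∷ zs) (x≉y ∷ _)   (here z≈y) z≈w = x≉y (≈-trans x≈w (≈-trans (≈-sym z≈w) z≈y))
      distinct (y ∷ zs) (_ ∷ x≉zs) (there z∈) z≈w = distinct zs x≉zs z∈ z≈w
      xs⊆us++vs : ∀ {z} → z ∈ xs → z ∈ us ++ vs
      xs⊆us++vs {z} z∈xs with ∈-++⁻ S us (∈-resp-≋ S ys≋ (xs⊆ys (there z∈xs)))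
      ... | inj₁ z∈us         = ∈-++⁺ˡ S z∈us
      ... | inj₂ (here z≈w)   = ⊥-elim (distinct xs x≉xs z∈xs z≈w)
      ... | inj₂ (there z∈vs) = ∈-++⁺ʳ S us z∈vs

    module _ {P : X → Set} (P? : Decidable P) (resp : ∀ {x y} → x ≈ y → P x → P y) where

      private
        filter-mono : ∀ {xs ys} → (∀ {z} → z ∈ xs → z ∈ ys) → ∀ {z} → z ∈ filter P? xs → z ∈ filter P? ys
        filter-mono xs⊆ys z∈ with z∈xs , pz ← ∈-filter⁻ S P? resp z∈ = ∈-filter⁺ S P? resp (xs⊆ys z∈xs) pz

      count-sameMembers : ∀ xs ys → Unique xs → Unique ys →
                          (∀ {z} → z ∈ xs → z ∈ ys) → (∀ {z} → z ∈ ys → z ∈ xs) → count P? xs ≡ count P? ys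
      count-sameMembers xs ys uxs uys xs⊆ys ys⊆xs = ≤-antisym
        (unique-length-≤ (filter P? xs) (filter P? ys) (SetoidUniqueₚ.filter⁺ S P? uxs) (filter-mono xs⊆ys))
        (unique-length-≤ (filter P? ys) (filter P? xs) (SetoidUniqueₚ.filter⁺ S P? uys) (filter-mono ys⊆xs))

    module _ {Y : Set} (f : Y → X) {P : X → Set} (P? : Decidable P) (resp : ∀ {x y} → x ≈ y → P x → P y) where
      open Mem≡ using () renaming (_∈_ to _∈≡_)

      private
        map-unique : ∀ ys → Unique≡.Unique ys → (∀ {y y′} → y ∈≡ ys → y′ ∈≡ ys → f y ≈ f y′ → y ≡ y′) →
                     Unique (map f ys)
        map-unique []       []           _   = []
        map-unique (y ∷ ys) (y∉ys ∷ uys) inj =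
          fresh ys y∉ys (λ y′∈ → inj (here refl) (there y′∈)) ∷ map-unique ys uys (λ i j → inj (there i) (there j))
          where
          fresh : ∀ zs → All (y ≢_) zs → (∀ {z} → z ∈≡ zs → f y ≈ f z → y ≡ z) → All (λ x → ¬ f y ≈ x) (map f zs)
          fresh []       []            _   = []
          fresh (z ∷ zs) (y≢z ∷ y≢zs) inj′ =
            (λ fy≈fz → y≢z (inj′ (here refl) fy≈fz)) ∷ fresh zs y≢zs (λ i → inj′ (there i))

      count-bijection : ∀ xs ys → Unique xs → Unique≡.Unique ys →
        (∀ {y} → y ∈≡ ys → f y ∈ xs) →
        (∀ {x} → x ∈ xs → Σ Y λ y → y ∈≡ ys × x ≈ f y) →
        (∀ {y y′} → y ∈≡ ys → y′ ∈≡ ys → f y ≈ f y′ → y ≡ y′) →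
        count P? xs ≡ count (λ y → P? (f y)) ys
      count-bijection xs ys uxs uys into onto inj =
        trans (count-sameMembers P? resp xs (map f ys) uxs (map-unique ys uys inj) xs⊆image image⊆xs)
              (count-map P? f ys)
        where
        xs⊆image : ∀ {z} → z ∈ xs → z ∈ map f ys
        xs⊆image z∈xs with y , y∈ys , z≈fy ← onto z∈xs =
          ∈-resp-≈ S (≈-sym z≈fy) (∈-map⁺ (≡-setoid Y) S (λ { refl → ≈-refl }) y∈ys)
        image⊆xs : ∀ {z} → z ∈ map f ys → z ∈ xs
        image⊆xs z∈ with y , y∈ys , z≈fy ← ∈-map⁻ (≡-setoid Y) S z∈ = ∈-resp-≈ S (≈-sym z≈fy) (into y∈ys)

  module FunctionEnumeration {A : Set} where

    _∈ᶠ_ : ∀ {ℓ} → (Fin ℓ → A) → List (Fin ℓ → A) → Set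
    _∈ᶠ_ {ℓ} = SetoidMembership._∈_ (Fin ℓ →-setoid A)

    Uniqueᶠ : ∀ {ℓ} → List (Fin ℓ → A) → Set
    Uniqueᶠ {ℓ} = SetoidUnique.Unique (Fin ℓ →-setoid A)

    private
      block : ∀ {ℓ} → List (Fin ℓ → A) → A → List (Fin (suc ℓ) → A)
      block fs a = map (extend a) fs

      block-head : ∀ {ℓ} {fs : List (Fin ℓ → A)} {a} {g : Fin (suc ℓ) → A} → g ∈ᶠ block fs a → g Fin.zero ≡ a
      block-head {ℓ} g∈ with h , _ , g≗ ← ∈-map⁻ (Fin ℓ →-setoid A) (Fin (suc ℓ) →-setoid A) g∈ = g≗ Fin.zero

    allFuns-complete : ∀ (xs : List A) ℓ (f : Fin ℓ → A) → (∀ p → f p Mem≡.∈ xs) → f ∈ᶠ allFuns xs ℓ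
    allFuns-complete xs zero    f _      = here (λ ())
    allFuns-complete xs (suc ℓ) f values =
      ∈-concatMap⁺ (≡-setoid A) (Fin (suc ℓ) →-setoid A)
        (Data.List.Relation.Unary.Any.map (λ { refl → f∈block }) (values Fin.zero))
      where
      tail∈ : (λ p → f (Fin.suc p)) ∈ᶠ allFuns xs ℓ
      tail∈ = allFuns-complete xs ℓ (λ p → f (Fin.suc p)) (λ p → values (Fin.suc p))
      f∈block : f ∈ᶠ block (allFuns xs ℓ) (f Fin.zero)
      f∈block = ∈-resp-≈ (Fin (suc ℓ) →-setoid A) (λ { Fin.zero → refl ; (Fin.suc p) → refl })
                  (∈-map⁺ (Fin ℓ →-setoid A) (Fin (suc ℓ) →-setoid A)
                     (λ { f≗g Fin.zero → refl ; f≗g (Fin.suc p) → f≗g p }) tail∈)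

    allFuns-unique : ∀ (xs : List A) ℓ → Unique≡.Unique xs → Uniqueᶠ (allFuns xs ℓ)
    allFuns-unique xs zero    _   = [] ∷ []
    allFuns-unique xs (suc ℓ) uxs =
      SetoidUniqueₚ.concat⁺ (Fin (suc ℓ) →-setoid A)
        (All.map⁺ (All.tabulate (λ _ → blocks-unique)))
        (AllPairsₚ.map⁺ (AllPairs.map blocks-disjoint uxs))
      where
      blocks-unique : ∀ {a} → Uniqueᶠ (block (allFuns xs ℓ) a)
      blocks-unique = SetoidUniqueₚ.map⁺ (Fin ℓ →-setoid A) (Fin (suc ℓ) →-setoid A)
                        (λ e p → e (Fin.suc p)) (allFuns-unique xs ℓ uxs)
      blocks-disjoint : ∀ {a b} → a ≢ b → ∀ {g} → ¬ (g ∈ᶠ block (allFuns xs ℓ) a × g ∈ᶠ block (allFuns xs ℓ) b)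
      blocks-disjoint a≢b (g∈a , g∈b) = a≢b (trans (sym (block-head g∈a)) (block-head g∈b))

module FiniteSums where

  open Counting
  open import Data.Nat using (ℕ; zero; suc; _+_; _∸_; _≤_; _<_; _≤?_; z≤n; s≤s)
  open import Data.Nat.Properties using (+-0-commutativeMonoid; ≤-pred; ≰⇒>; <⇒≱; <-asym)
  open import Data.Fin as Fin using (Fin; toℕ; punchIn)
  open import Data.Fin.Properties using (punchIn-mono-≤; punchIn-cancel-≤)
  open import Data.Fin.Permutation using (permutation)
  open import Data.List using (map; tabulate)
  open import Data.Nat.ListAction using (sum)
  open import Algebra.Properties.CommutativeMonoid.Sum +-0-commutativeMonoid
    using (sum-cong-≗; sum-remove; sum-permute) renaming (sum to ∑)
  open import Data.Empty using (⊥-elim)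
  open import Relation.Binary.PropositionalEquality using (_≡_; refl; sym; trans; cong; cong₂; subst)
  open import Relation.Nullary using (Dec; yes; no; ¬_)
  open import Relation.Unary using (Decidable)

  𝟙 : ∀ {A : Set} → Dec A → ℕ
  𝟙 (yes _) = 1
  𝟙 (no _)  = 0

  𝟙-yes : ∀ {A : Set} (d : Dec A) → A → 𝟙 d ≡ 1
  𝟙-yes (yes _) _ = refl
  𝟙-yes (no ¬a) a = ⊥-elim (¬a a)

  𝟙-no : ∀ {A : Set} (d : Dec A) → ¬ A → 𝟙 d ≡ 0
  𝟙-no (yes a) ¬a = ⊥-elim (¬a a)
  𝟙-no (no _)  _  = refl

  𝟙-cong : ∀ {A B : Set} (d : Dec A) (e : Dec B) → (A → B) → (B → A) → 𝟙 d ≡ 𝟙 e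
  𝟙-cong (yes _) (yes _) _   _   = refl
  𝟙-cong (yes a) (no ¬b) a⇒b _   = ⊥-elim (¬b (a⇒b a))
  𝟙-cong (no ¬a) (yes b) _   b⇒a = ⊥-elim (¬a (b⇒a b))
  𝟙-cong (no _)  (no _)  _   _   = refl

  count-tabulate : ∀ {X : Set} {P : X → Set} (P? : Decidable P) {n} (f : Fin n → X) →
                   count P? (tabulate f) ≡ ∑ (λ i → 𝟙 (P? (f i)))
  count-tabulate P? {zero}  f = refl
  count-tabulate P? {suc n} f with P? (f Fin.zero)
  ... | yes _ = cong suc (count-tabulate P? (λ i → f (Fin.suc i)))
  ... | no _  = count-tabulate P? (λ i → f (Fin.suc i))

  sum-map-tabulate : ∀ {X : Set} {n} (f : Fin n → X) (h : X → ℕ) → sum (map h (tabulate f)) ≡ ∑ (λ i → h (f i))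
  sum-map-tabulate {n = zero}  f h = refl
  sum-map-tabulate {n = suc n} f h = cong (h (f Fin.zero) +_) (sum-map-tabulate (λ i → f (Fin.suc i)) h)

  ∑-zero : ∀ {n} (f : Fin n → ℕ) → (∀ i → f i ≡ 0) → ∑ f ≡ 0
  ∑-zero {zero}  f _     = refl
  ∑-zero {suc n} f zeros = cong₂ _+_ (zeros Fin.zero) (∑-zero (λ i → f (Fin.suc i)) (λ i → zeros (Fin.suc i)))

  ∑-one : ∀ {n} (f : Fin n → ℕ) → (∀ i → f i ≡ 1) → ∑ f ≡ n
  ∑-one {zero}  f _   = refl
  ∑-one {suc n} f one = cong₂ _+_ (one Fin.zero) (∑-one (λ i → f (Fin.suc i)) (λ i → one (Fin.suc i)))

  ∑-involution : ∀ {n} (τ : Fin n → Fin n) → (∀ i → τ (τ i) ≡ i) → (g : Fin n → ℕ) → ∑ (λ i → g (τ i)) ≡ ∑ g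
  ∑-involution τ inv g = sym (sum-permute g (permutation τ τ inv inv))

  count-≥ : ∀ n s → ∑ {n} (λ v → 𝟙 (s ≤? toℕ v)) ≡ n ∸ s
  count-≥ zero    zero    = refl
  count-≥ zero    (suc s) = refl
  count-≥ (suc n) zero    = cong suc (∑-one {n} (λ v → 𝟙 (0 ≤? toℕ (Fin.suc v))) (λ v → 𝟙-yes (0 ≤? toℕ (Fin.suc v)) z≤n))
  count-≥ (suc n) (suc s) =
    trans (cong₂ _+_ (𝟙-no (suc s ≤? 0) λ ())
                     (sum-cong-≗ {n} (λ v → 𝟙-cong (suc s ≤? toℕ (Fin.suc v)) (s ≤? toℕ v) ≤-pred s≤s)))
          (count-≥ n s)

  punchIn-below : ∀ {m} (s : Fin (suc m)) (p : Fin m) → toℕ p < toℕ s → toℕ (punchIn s p) ≡ toℕ p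
  punchIn-below Fin.zero    p            ()
  punchIn-below (Fin.suc s) Fin.zero     _         = refl
  punchIn-below (Fin.suc s) (Fin.suc p)  (s≤s p<s) = cong suc (punchIn-below s p p<s)

  punchIn-above : ∀ {m} (s : Fin (suc m)) (p : Fin m) → toℕ s ≤ toℕ p → toℕ (punchIn s p) ≡ suc (toℕ p)
  punchIn-above Fin.zero    p            _         = refl
  punchIn-above (Fin.suc s) Fin.zero     ()
  punchIn-above (Fin.suc s) (Fin.suc p)  (s≤s s≤p) = cong suc (punchIn-above s p s≤p)

  punchIn-<-mono : ∀ {m} (s : Fin (suc m)) {p q : Fin m} → toℕ p < toℕ q → toℕ (punchIn s p) < toℕ (punchIn s q)
  punchIn-<-mono s {p} {q} p<q = ≰⇒> (λ le → <⇒≱ p<q (punchIn-cancel-≤ s q p le))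

  punchIn-<-cancel : ∀ {m} (s : Fin (suc m)) {p q : Fin m} → toℕ (punchIn s p) < toℕ (punchIn s q) → toℕ p < toℕ q
  punchIn-<-cancel s {p} {q} lt = ≰⇒> (λ le → <⇒≱ lt (punchIn-mono-≤ s q p le))

  punchIn-beyond : ∀ {m} (s : Fin (suc m)) (p : Fin m) → toℕ s ≤ toℕ p → toℕ s < toℕ (punchIn s p)
  punchIn-beyond s p s≤p = subst (toℕ s <_) (sym (punchIn-above s p s≤p)) (s≤s s≤p)

  punchIn-beyond⁻ : ∀ {m} (s : Fin (suc m)) (p : Fin m) → toℕ s < toℕ (punchIn s p) → toℕ s ≤ toℕ p
  punchIn-beyond⁻ s p s<p′ with toℕ s ≤? toℕ p
  ... | yes s≤p = s≤p
  ... | no  s≰p = ⊥-elim (<-asym s<p′ (subst (_< toℕ s) (sym (punchIn-below s p (≰⇒> s≰p))) (≰⇒> s≰p)))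

-- Cycle insertion and removal in 123-avoiding involutions, the involutions
-- without such a cycle, and the final decreasing run.
module Involutions where

  open FiniteSums
  open import Data.Nat using (ℕ; zero; suc; _+_; _∸_; _≤_; _<_; z≤n; s≤s; _<?_)
  open import Data.Nat.Properties
    using (≤-refl; ≤-trans; ≤-antisym; ≤-reflexive; <⇒≤; ≤-pred; <-irrefl; <-asym; <-cmp; ≮⇒≥; n≤1+n; n<1+n;
           m≤m+n; m≤n+m; +-suc; +-comm; +-identityʳ; +-monoˡ-≤; m∸n≤m; n∸n≡0; m∸[m∸n]≡n; +-∸-assoc;
           m+[n∸m]≡n; m+n∸n≡m; ∸-monoʳ-≤; ∸-monoʳ-<; m+n≤o⇒m≤o∸n; m≤o∸n⇒m+n≤o)
  open import Data.Fin as Fin using (Fin; zero; suc; toℕ; punchIn; punchOut; opposite; fromℕ; fromℕ<)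
  open import Data.Fin.Properties
    using (_≟_; punchIn-punchOut; punchOut-cong; punchOut-punchIn; toℕ-injective; punchInᵢ≢i;
           punchIn-injective; suc-injective; toℕ<n; toℕ-fromℕ<; toℕ-fromℕ; opposite-prop; opposite-involutive)
  open import Data.Product using (Σ; _×_; _,_; proj₁; proj₂)
  open import Data.Empty using (⊥; ⊥-elim)
  open import Relation.Binary using (tri<; tri≈; tri>)
  open import Relation.Binary.PropositionalEquality
    using (_≡_; _≢_; _≗_; refl; sym; trans; cong; subst; subst₂; module ≡-Reasoning)
  open import Relation.Nullary using (yes; no)

  Perm : ℕ → Set
  Perm n = Fin n → Fin n

  involution-injective : ∀ {n} (σ : Perm n) → IsInvolution σ → ∀ {p q} → σ p ≡ σ q → p ≡ q
  involution-injective σ inv {p} {q} σp≡σq = trans (sym (inv p)) (trans (cong σ σp≡σq) (inv q))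

  <-subst : ∀ {m k} {a a′ : Fin m} {b b′ : Fin k} → a ≡ a′ → b ≡ b′ → toℕ a < toℕ b → toℕ a′ < toℕ b′
  <-subst refl refl a<b = a<b

  involution-resp : ∀ {n} {σ σ′ : Perm n} → σ ≗ σ′ → IsInvolution σ → IsInvolution σ′
  involution-resp {σ = σ} {σ′} σ≗σ′ inv i = trans (sym (σ≗σ′ (σ′ i))) (trans (cong σ (sym (σ≗σ′ i))) (inv i))

  avoids-resp : ∀ {n} {σ σ′ : Perm n} → σ ≗ σ′ → Avoids123 σ → Avoids123 σ′
  avoids-resp σ≗σ′ avoids (i , j , l , i<j , j<l , σi<σj , σj<σl) =
    avoids (i , j , l , i<j , j<l , <-subst (sym (σ≗σ′ i)) (sym (σ≗σ′ j)) σi<σj , <-subst (sym (σ≗σ′ j)) (sym (σ≗σ′ l)) σj<σl)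

  -- addCycle τ s is the map of [n+2] exchanging 0 and s+1 and acting on the
  -- remaining positions 1 + punchIn s p as τ does on p.  Every 123-avoiding
  -- involution without fixed point 0 arises this way (module RemoveCycle).
  addCycle : ∀ {n} → Perm n → Fin (suc n) → Perm (suc (suc n))
  addCycle τ s zero    = suc s
  addCycle τ s (suc y) with s ≟ y
  ... | yes _  = zero
  ... | no s≢y = suc (punchIn s (τ (punchOut s≢y)))

  addCycle-partner : ∀ {n} (τ : Perm n) s → addCycle τ s (suc s) ≡ zero
  addCycle-partner τ s with s ≟ s
  ... | yes _  = refl
  ... | no s≢s = ⊥-elim (s≢s refl)

  addCycle-punchIn : ∀ {n} (τ : Perm n) s p → addCycle τ s (suc (punchIn s p)) ≡ suc (punchIn s (τ p))
  addCycle-punchIn τ s p with s ≟ punchIn s p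
  ... | yes s≡ = ⊥-elim (punchInᵢ≢i s p (sym s≡))
  ... | no s≢  = cong (λ z → suc (punchIn s (τ z))) (trans (punchOut-cong s refl) (punchOut-punchIn s))

  data Position {n} (s : Fin (suc n)) : Fin (suc (suc n)) → Set where
    atZero    : Position s zero
    atPartner : Position s (suc s)
    atPunched : (p : Fin n) → Position s (suc (punchIn s p))

  position : ∀ {n} (s : Fin (suc n)) x → Position s x
  position s zero    = atZero
  position s (suc y) with s ≟ y
  ... | yes refl = atPartner
  ... | no s≢y   = subst (λ z → Position s (suc z)) (punchIn-punchOut s≢y) (atPunched (punchOut s≢y))

  addCycle-involution : ∀ {n} (τ : Perm n) s → IsInvolution τ → IsInvolution (addCycle τ s)
  addCycle-involution τ s inv x with position s x
  ... | atZero      = addCycle-partner τ s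
  ... | atPartner   = cong (addCycle τ s) (addCycle-partner τ s)
  ... | atPunched p = trans (cong (addCycle τ s) (addCycle-punchIn τ s p))
                            (trans (addCycle-punchIn τ s (τ p)) (cong (λ z → suc (punchIn s z)) (inv p)))

  addCycle-injective : ∀ {n} (τ τ′ : Perm n) s s′ → addCycle τ s ≗ addCycle τ′ s′ → (s ≡ s′) × (τ ≗ τ′)
  addCycle-injective τ τ′ s s′ same with suc-injective (same zero)
  ... | refl = refl , λ p → punchIn-injective s (τ p) (τ′ p) (suc-injective
                 (trans (sym (addCycle-punchIn τ s p)) (trans (same (suc (punchIn s p))) (addCycle-punchIn τ′ s p))))

  addCycle-cong : ∀ {n} {τ τ′ : Perm n} s → τ ≗ τ′ → addCycle τ s ≗ addCycle τ′ s
  addCycle-cong {τ = τ} {τ′} s τ≗τ′ x with position s x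
  ... | atZero      = refl
  ... | atPartner   = trans (addCycle-partner τ s) (sym (addCycle-partner τ′ s))
  ... | atPunched p = trans (addCycle-punchIn τ s p)
                            (trans (cong (λ z → suc (punchIn s z)) (τ≗τ′ p)) (sym (addCycle-punchIn τ′ s p)))

  DecreasingFrom : ∀ {n} → Perm n → ℕ → Set
  DecreasingFrom {n} τ e = ∀ (p q : Fin n) → e ≤ toℕ p → toℕ p < toℕ q → toℕ (τ q) < toℕ (τ p)

  decreasingFrom-mono : ∀ {n} {τ : Perm n} {e e′} → e ≤ e′ → DecreasingFrom τ e → DecreasingFrom τ e′
  decreasingFrom-mono e≤e′ dec p q e′≤p p<q = dec p q (≤-trans e≤e′ e′≤p) p<q

  -- Adding the cycle (0 s+1) to a 123-avoiding involution decreasing from s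
  -- keeps it 123-avoiding: an occurrence of 123 through 0 or s+1 would need an
  -- ascent of τ beyond s.
  addCycle-avoids : ∀ {n} (τ : Perm n) s → IsInvolution τ → Avoids123 τ → DecreasingFrom τ (toℕ s) →
                    Avoids123 (addCycle τ s)
  addCycle-avoids {n} τ s inv avoids dec (i , j , l , i<j , j<l , σi<σj , σj<σl) =
    no123 (position s i) (position s j) (position s l) i<j j<l σi<σj σj<σl
    where
    σ : Perm (suc (suc n))
    σ = addCycle τ s
    below-zero : ∀ x → toℕ (σ x) < toℕ (σ (suc s)) → ⊥
    below-zero x lt with subst (λ z → toℕ (σ x) < toℕ z) (addCycle-partner τ s) lt
    ... | ()
    no123 : ∀ {i j l} → Position s i → Position s j → Position s l →
              toℕ i < toℕ j → toℕ j < toℕ l → toℕ (σ i) < toℕ (σ j) → toℕ (σ j) < toℕ (σ l) → ⊥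
    no123 _ atZero _ () _ _ _
    no123 _ _ atZero _ () _ _
    no123 {i} _ atPartner _ _ _ σi<σj _ = below-zero i σi<σj
    no123 {j = j} _ _ atPartner _ _ _ σj<σl = below-zero j σj<σl
    no123 atZero (atPunched p) (atPunched q) _ p<q σ0<σp σp<σq =
      <-asym (punchIn-<-cancel s (≤-pred p<q))
             (<-subst (inv q) (inv p) (dec (τ p) (τ q) (punchIn-beyond⁻ s (τ p) (≤-pred s<τp)) (punchIn-<-cancel s (≤-pred τp<τq))))
      where
      s<τp : toℕ (suc s) < toℕ (suc (punchIn s (τ p)))
      s<τp = subst (λ z → toℕ (suc s) < toℕ z) (addCycle-punchIn τ s p) σ0<σp
      τp<τq : toℕ (suc (punchIn s (τ p))) < toℕ (suc (punchIn s (τ q)))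
      τp<τq = <-subst (addCycle-punchIn τ s p) (addCycle-punchIn τ s q) σp<σq
    no123 atPartner (atPunched p) (atPunched q) s<p p<q _ σp<σq =
      <-asym (punchIn-<-cancel s (≤-pred (<-subst (addCycle-punchIn τ s p) (addCycle-punchIn τ s q) σp<σq)))
             (dec p q (punchIn-beyond⁻ s p (≤-pred s<p)) (punchIn-<-cancel s (≤-pred p<q)))
    no123 (atPunched p) (atPunched q) (atPunched r) p<q q<r σp<σq σq<σr =
      avoids (p , q , r , punchIn-<-cancel s (≤-pred p<q) , punchIn-<-cancel s (≤-pred q<r) ,
              punchIn-<-cancel s (≤-pred (<-subst (addCycle-punchIn τ s p) (addCycle-punchIn τ s q) σp<σq)) ,
              punchIn-<-cancel s (≤-pred (<-subst (addCycle-punchIn τ s q) (addCycle-punchIn τ s r) σq<σr)))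

  -- Conversely, a 123-avoiding involution σ of [n+2] with σ(0) = s+1 is
  -- addCycle τ s for a 123-avoiding involution τ of [n] decreasing from s.
  module RemoveCycle {n} (σ : Perm (suc (suc n))) (inv : IsInvolution σ) (avoids : Avoids123 σ)
                     (s : Fin (suc n)) (σ0 : σ zero ≡ suc s) where

    σ-partner : σ (suc s) ≡ zero
    σ-partner = trans (cong σ (sym σ0)) (inv zero)

    private
      unpunch : Fin n → Fin (suc (suc n)) → Fin n
      unpunch d zero    = d
      unpunch d (suc v) with s ≟ v
      ... | yes _  = d
      ... | no s≢v = punchOut s≢v

      unpunch-correct : ∀ d v → s ≢ v → suc (punchIn s (unpunch d (suc v))) ≡ suc v
      unpunch-correct d v s≢v with s ≟ v
      ... | yes s≡v = ⊥-elim (s≢v s≡v)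
      ... | no s≢v′ = cong suc (punchIn-punchOut s≢v′)

    τ : Perm n
    τ p = unpunch p (σ (suc (punchIn s p)))

    σ-punchIn : ∀ p → σ (suc (punchIn s p)) ≡ suc (punchIn s (τ p))
    σ-punchIn p with σ (suc (punchIn s p)) in eq
    ... | zero  = ⊥-elim (punchInᵢ≢i s p (suc-injective (trans (sym (inv (suc (punchIn s p)))) (trans (cong σ eq) σ0))))
    ... | suc v = sym (unpunch-correct p v s≢v)
      where
      s≢v : s ≢ v
      s≢v refl with involution-injective σ inv {suc (punchIn s p)} {zero} (trans eq (sym σ0))
      ... | ()

    τ-involution : IsInvolution τ
    τ-involution p = punchIn-injective s (τ (τ p)) p (suc-injective
      (trans (sym (σ-punchIn (τ p))) (trans (cong σ (sym (σ-punchIn p))) (inv (suc (punchIn s p))))))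

    τ-avoids : Avoids123 τ
    τ-avoids (p , q , r , p<q , q<r , τp<τq , τq<τr) =
      avoids (suc (punchIn s p) , suc (punchIn s q) , suc (punchIn s r) ,
              s≤s (punchIn-<-mono s p<q) , s≤s (punchIn-<-mono s q<r) ,
              <-subst (sym (σ-punchIn p)) (sym (σ-punchIn q)) (s≤s (punchIn-<-mono s τp<τq)) ,
              <-subst (sym (σ-punchIn q)) (sym (σ-punchIn r)) (s≤s (punchIn-<-mono s τq<τr)))

    -- An ascent of τ beyond s would form a 123 with s+1, whose value is 0.
    τ-decreasing : DecreasingFrom τ (toℕ s)
    τ-decreasing p q s≤p p<q with <-cmp (toℕ (τ q)) (toℕ (τ p))
    ... | tri< τq<τp _ _ = τq<τp
    ... | tri≈ _ τq≡τp _ with involution-injective τ τ-involution {q} {p} (toℕ-injective τq≡τp)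
    ...   | refl = ⊥-elim (<-irrefl refl p<q)
    τ-decreasing p q s≤p p<q | tri> _ _ τp<τq =
      ⊥-elim (avoids (suc s , suc (punchIn s p) , suc (punchIn s q) ,
                      s≤s (punchIn-beyond s p s≤p) , s≤s (punchIn-<-mono s p<q) ,
                      <-subst (sym σ-partner) (sym (σ-punchIn p)) (s≤s z≤n) ,
                      <-subst (sym (σ-punchIn p)) (sym (σ-punchIn q)) (s≤s (punchIn-<-mono s τp<τq))))

    σ≗addCycle : σ ≗ addCycle τ s
    σ≗addCycle x with position s x
    ... | atZero      = σ0
    ... | atPartner   = trans σ-partner (sym (addCycle-partner τ s))
    ... | atPunched p = trans (σ-punchIn p) (sym (addCycle-punchIn τ s p))

  opposite-decreasing : ∀ {m} (p q : Fin m) → toℕ p < toℕ q → toℕ (opposite q) < toℕ (opposite p)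
  opposite-decreasing {m} p q p<q =
    subst₂ _<_ (sym (opposite-prop q)) (sym (opposite-prop p)) (∸-monoʳ-< (s≤s p<q) (toℕ<n q))

  -- The only strictly decreasing map of [m] is opposite (i ↦ m-1-i): moving
  -- one step left raises the value by at least one, and one step right lowers
  -- it by at least one, so ρ(p) + p is exactly m - 1.
  module Decreasing {m} (ρ : Perm m) (decreasing : ∀ p q → toℕ p < toℕ q → toℕ (ρ q) < toℕ (ρ p)) where

    private
      upper : ∀ k (p : Fin m) → toℕ p ≡ k → suc (toℕ (ρ p) + k) ≤ m
      upper zero    p _  = subst (λ z → suc z ≤ m) (sym (+-identityʳ (toℕ (ρ p)))) (toℕ<n (ρ p))
      upper (suc k) p p≡ = ≤-trans step (upper k p′ p′≡)
        where
        k<m : k < m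
        k<m = ≤-trans (n≤1+n (suc k)) (subst (λ z → suc z ≤ m) p≡ (toℕ<n p))
        p′ : Fin m
        p′ = fromℕ< k<m
        p′≡ : toℕ p′ ≡ k
        p′≡ = toℕ-fromℕ< k<m
        step : suc (toℕ (ρ p) + suc k) ≤ suc (toℕ (ρ p′) + k)
        step = subst (λ z → suc z ≤ suc (toℕ (ρ p′) + k)) (sym (+-suc (toℕ (ρ p)) k))
                 (s≤s (+-monoˡ-≤ k (decreasing p′ p (subst₂ _<_ (sym p′≡) (sym p≡) (n<1+n k)))))

      lower : ∀ d (p : Fin m) → suc (toℕ p + d) ≡ m → m ≤ suc (toℕ (ρ p) + toℕ p)
      lower zero    p p≡ = subst (_≤ suc (toℕ (ρ p) + toℕ p)) (trans (cong suc (sym (+-identityʳ (toℕ p)))) p≡)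
                             (s≤s (m≤n+m (toℕ p) (toℕ (ρ p))))
      lower (suc d) p p≡ = ≤-trans (lower d p′ p′+d≡) step
        where
        p+1<m : suc (toℕ p) < m
        p+1<m = subst (suc (suc (toℕ p)) ≤_) p≡
                  (s≤s (subst (suc (toℕ p) ≤_) (sym (+-suc (toℕ p) d)) (s≤s (m≤m+n (toℕ p) d))))
        p′ : Fin m
        p′ = fromℕ< p+1<m
        p′≡ : toℕ p′ ≡ suc (toℕ p)
        p′≡ = toℕ-fromℕ< p+1<m
        p′+d≡ : suc (toℕ p′ + d) ≡ m
        p′+d≡ = trans (cong (λ z → suc (z + d)) p′≡) (trans (cong suc (sym (+-suc (toℕ p) d))) p≡)
        step : suc (toℕ (ρ p′) + toℕ p′) ≤ suc (toℕ (ρ p) + toℕ p)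
        step = subst (λ z → suc (toℕ (ρ p′) + z) ≤ suc (toℕ (ρ p) + toℕ p)) (sym p′≡)
                 (s≤s (subst (_≤ toℕ (ρ p) + toℕ p) (sym (+-suc (toℕ (ρ p′)) (toℕ p)))
                    (+-monoˡ-≤ (toℕ p) (decreasing p p′ (subst (toℕ p <_) (sym p′≡) (n<1+n (toℕ p)))))))

    ρ≗opposite : ρ ≗ opposite
    ρ≗opposite p = toℕ-injective (trans ρp≡ (sym (opposite-prop p)))
      where
      total : suc (toℕ (ρ p) + toℕ p) ≡ m
      total = ≤-antisym (upper (toℕ p) p refl) (lower (m ∸ suc (toℕ p)) p (m+[n∸m]≡n (toℕ<n p)))
      ρp≡ : toℕ (ρ p) ≡ m ∸ suc (toℕ p)
      ρp≡ = trans (sym (m+n∸n≡m (toℕ (ρ p)) (suc (toℕ p))))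
                  (cong (_∸ suc (toℕ p)) (trans (+-suc (toℕ (ρ p)) (toℕ p)) total))

  fixedThenDecreasing : ∀ {m} → Perm (suc m)
  fixedThenDecreasing zero    = zero
  fixedThenDecreasing (suc i) = suc (opposite i)

  -- A 123-avoiding involution fixing 0 is fixedThenDecreasing: a 0 in front
  -- forbids any ascent among the remaining positions.
  fixedHead : ∀ {m} (σ : Perm (suc m)) → IsInvolution σ → Avoids123 σ → σ zero ≡ zero → σ ≗ fixedThenDecreasing
  fixedHead {m} σ inv avoids σ0 = σ≗
    where
    σ-suc : ∀ p → Σ (Fin m) λ v → σ (suc p) ≡ suc v
    σ-suc p with σ (suc p) in eq
    ... | zero with involution-injective σ inv {suc p} {zero} (trans eq (sym σ0))
    ...   | ()
    σ-suc p | suc v = v , refl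
    ρ : Perm m
    ρ p = proj₁ (σ-suc p)
    σ-ρ : ∀ p → σ (suc p) ≡ suc (ρ p)
    σ-ρ p = proj₂ (σ-suc p)
    ρ-decreasing : ∀ p q → toℕ p < toℕ q → toℕ (ρ q) < toℕ (ρ p)
    ρ-decreasing p q p<q with <-cmp (toℕ (ρ q)) (toℕ (ρ p))
    ... | tri< ρq<ρp _ _ = ρq<ρp
    ... | tri≈ _ ρq≡ρp _ with involution-injective σ inv {suc q} {suc p} (trans (σ-ρ q) (trans (cong suc (toℕ-injective ρq≡ρp)) (sym (σ-ρ p))))
    ...   | refl = ⊥-elim (<-irrefl refl p<q)
    ρ-decreasing p q p<q | tri> _ _ ρp<ρq =
      ⊥-elim (avoids (zero , suc p , suc q , s≤s z≤n , s≤s p<q ,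
                      <-subst (sym σ0) (sym (σ-ρ p)) (s≤s z≤n) , <-subst (sym (σ-ρ p)) (sym (σ-ρ q)) (s≤s ρp<ρq)))
    σ≗ : σ ≗ fixedThenDecreasing
    σ≗ zero    = σ0
    σ≗ (suc p) = trans (σ-ρ p) (cong suc (Decreasing.ρ≗opposite ρ ρ-decreasing p))

  opposite-avoids : ∀ {n} → Avoids123 (opposite {n})
  opposite-avoids (i , j , l , i<j , _ , σi<σj , _) = <-asym σi<σj (opposite-decreasing i j i<j)

  fixedThenDecreasing-involution : ∀ {m} → IsInvolution (fixedThenDecreasing {m})
  fixedThenDecreasing-involution zero    = refl
  fixedThenDecreasing-involution (suc i) = cong suc (opposite-involutive i)

  fixedThenDecreasing-avoids : ∀ {m} → Avoids123 (fixedThenDecreasing {m})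
  fixedThenDecreasing-avoids (i , zero , l , () , _ , _ , _)
  fixedThenDecreasing-avoids (i , suc j , zero , _ , () , _ , _)
  fixedThenDecreasing-avoids (i , suc j , suc l , _ , s≤s j<l , _ , s≤s σj<σl) = <-asym σj<σl (opposite-decreasing j l j<l)

  AscentAt : ∀ {n} → Perm n → ℕ → Set
  AscentAt {n} τ e = Σ (Fin n) λ p → Σ (Fin n) λ q → (toℕ p ≡ e) × (toℕ q ≡ suc e) × (toℕ (τ p) < toℕ (τ q))

  -- FinalRun τ m: the longest decreasing final segment of τ has length m - 1,
  -- i.e. τ decreases on its last m - 1 positions and ascends just before them.
  record FinalRun {n} (τ : Perm n) (m : ℕ) : Set where
    field
      positive   : 1 ≤ m
      bounded    : m ≤ suc n
      decreasing : DecreasingFrom τ (suc n ∸ m)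
      ascent     : m ≤ n → AscentAt τ (n ∸ m)
  open FinalRun public

  finalRun-resp : ∀ {n} {σ σ′ : Perm n} {m} → σ ≗ σ′ → FinalRun σ m → FinalRun σ′ m
  finalRun-resp σ≗σ′ run = record
    { positive   = positive run
    ; bounded    = bounded run
    ; decreasing = λ p q e≤p p<q → <-subst (σ≗σ′ q) (σ≗σ′ p) (decreasing run p q e≤p p<q)
    ; ascent     = λ m≤n → let (p , q , p≡ , q≡ , σp<σq) = ascent run m≤n
                           in p , q , p≡ , q≡ , <-subst (σ≗σ′ p) (σ≗σ′ q) σp<σq
    }

  decreasingFrom⇔ : ∀ {n} {τ : Perm n} {m} → FinalRun τ m → ∀ s → s ≤ n →
                    (DecreasingFrom τ s → n ∸ s < m) × (n ∸ s < m → DecreasingFrom τ s)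
  decreasingFrom⇔ {n} {τ} {m} run s s≤n = only-if , if
    where
    if : n ∸ s < m → DecreasingFrom τ s
    if n∸s<m = decreasingFrom-mono (≤-trans (∸-monoʳ-≤ (suc n) n∸s<m) (≤-reflexive (m∸[m∸n]≡n s≤n))) (decreasing run)
    only-if : DecreasingFrom τ s → n ∸ s < m
    only-if dec with n ∸ s <? m
    ... | yes n∸s<m = n∸s<m
    ... | no  n∸s≮m with p , q , p≡ , q≡ , τp<τq ← ascent run (≤-trans (≮⇒≥ n∸s≮m) (m∸n≤m n s)) =
      ⊥-elim (<-asym τp<τq (dec p q s≤p (subst₂ _<_ (sym p≡) (sym q≡) (n<1+n (n ∸ m)))))
      where
      s≤p : s ≤ toℕ p
      s≤p = subst (s ≤_) (sym p≡) (m+n≤o⇒m≤o∸n s (subst (_≤ n) (+-comm m s) (m≤o∸n⇒m+n≤o m s≤n (≮⇒≥ n∸s≮m))))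

  finalRun-opposite : ∀ {n} → FinalRun (opposite {n}) (suc n)
  finalRun-opposite = record
    { positive   = s≤s z≤n
    ; bounded    = ≤-refl
    ; decreasing = λ p q _ p<q → opposite-decreasing p q p<q
    ; ascent     = λ n+1≤n → ⊥-elim (<-irrefl refl n+1≤n)
    }

  private
    suc-∸ : ∀ n m → m ≤ n → suc n ∸ m ≡ suc (n ∸ m)
    suc-∸ n       zero    _         = refl
    suc-∸ (suc n) (suc m) (s≤s m≤n) = suc-∸ n m m≤n

  finalRun-fixed : ∀ {m} → FinalRun (fixedThenDecreasing {suc m}) (suc (suc m))
  finalRun-fixed {m} = record
    { positive   = s≤s z≤n
    ; bounded    = n≤1+n _
    ; decreasing = subst (DecreasingFrom fixedThenDecreasing)
                         (sym (trans (suc-∸ (suc m) (suc m) ≤-refl) (cong suc (n∸n≡0 (suc m))))) decreasing-from-1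
    ; ascent     = λ _ → zero , suc zero , sym (n∸n≡0 (suc m)) , cong suc (sym (n∸n≡0 (suc m))) , s≤s z≤n
    }
    where
    decreasing-from-1 : DecreasingFrom (fixedThenDecreasing {suc m}) 1
    decreasing-from-1 zero    q       ()
    decreasing-from-1 (suc p) zero    _ ()
    decreasing-from-1 (suc p) (suc q) _ (s≤s p<q) = s≤s (opposite-decreasing p q p<q)

  finalRun-addCycle-inner : ∀ {n} (τ : Perm n) (s : Fin (suc n)) → toℕ s < n → DecreasingFrom τ (toℕ s) →
                            FinalRun (addCycle τ s) (suc (n ∸ toℕ s))
  finalRun-addCycle-inner {n} τ s s<n dec = record
    { positive   = s≤s z≤n
    ; bounded    = s≤s (≤-trans (m∸n≤m n (toℕ s)) (≤-trans (n≤1+n n) (n≤1+n (suc n))))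
    ; decreasing = subst (DecreasingFrom σ) (sym start≡) decreasing-after
    ; ascent     = λ _ → subst (AscentAt σ) (sym ascent≡) ascent-at-partner
    }
    where
    σ : Perm (suc (suc n))
    σ = addCycle τ s
    s≤n : toℕ s ≤ n
    s≤n = <⇒≤ s<n
    start≡ : suc (suc n) ∸ (n ∸ toℕ s) ≡ suc (suc (toℕ s))
    start≡ = trans (+-∸-assoc 2 (m∸n≤m n (toℕ s))) (cong (λ z → suc (suc z)) (m∸[m∸n]≡n s≤n))
    ascent≡ : suc n ∸ (n ∸ toℕ s) ≡ suc (toℕ s)
    ascent≡ = trans (+-∸-assoc 1 (m∸n≤m n (toℕ s))) (cong suc (m∸[m∸n]≡n s≤n))
    decreasing-after : DecreasingFrom σ (suc (suc (toℕ s)))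
    decreasing-after x y = go (position s x) (position s y)
      where
      go : ∀ {x y} → Position s x → Position s y → suc (suc (toℕ s)) ≤ toℕ x → toℕ x < toℕ y → toℕ (σ y) < toℕ (σ x)
      go atZero         _             ()          _
      go atPartner      _             (s≤s s+1≤s) _ = ⊥-elim (<-irrefl refl s+1≤s)
      go (atPunched p)  atZero        _ ()
      go (atPunched p)  atPartner     p>s+1 p<s+1 = ⊥-elim (<-asym (≤-pred p<s+1) (≤-pred p>s+1))
      go (atPunched p)  (atPunched q) p>s+1 p<q   =
        <-subst (sym (addCycle-punchIn τ s q)) (sym (addCycle-punchIn τ s p))
          (s≤s (punchIn-<-mono s (dec p q (punchIn-beyond⁻ s p (≤-pred p>s+1)) (punchIn-<-cancel s (≤-pred p<q)))))
    next : Fin n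
    next = fromℕ< s<n
    next≡ : toℕ next ≡ toℕ s
    next≡ = toℕ-fromℕ< s<n
    ascent-at-partner : AscentAt σ (suc (toℕ s))
    ascent-at-partner =
      suc s , suc (punchIn s next) , refl ,
      cong suc (trans (punchIn-above s next (≤-reflexive (sym next≡))) (cong suc next≡)) ,
      <-subst (sym (addCycle-partner τ s)) (sym (addCycle-punchIn τ s next)) (s≤s z≤n)

  finalRun-addCycle-last : ∀ {n} (τ : Perm n) (s : Fin (suc n)) m → toℕ s ≡ n → FinalRun τ m → m ≤ n →
                           FinalRun (addCycle τ s) (suc m)
  finalRun-addCycle-last {n} τ s m s≡n run m≤n = record
    { positive   = s≤s z≤n
    ; bounded    = s≤s (≤-trans m≤n (≤-trans (n≤1+n n) (n≤1+n (suc n))))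
    ; decreasing = subst (DecreasingFrom σ) (sym (suc-∸ (suc n) m (bounded run))) decreasing-σ
    ; ascent     = λ _ → subst (AscentAt σ) (sym (suc-∸ n m m≤n)) ascent-σ
    }
    where
    σ : Perm (suc (suc n))
    σ = addCycle τ s
    below-s : ∀ (p : Fin n) → toℕ p < toℕ s
    below-s p = subst (toℕ p <_) (sym s≡n) (toℕ<n p)
    punchIn-fixes : ∀ p → toℕ (punchIn s p) ≡ toℕ p
    punchIn-fixes p = punchIn-below s p (below-s p)
    decreasing-σ : DecreasingFrom σ (suc (suc n ∸ m))
    decreasing-σ x y = go (position s x) (position s y)
      where
      go : ∀ {x y} → Position s x → Position s y → suc (suc n ∸ m) ≤ toℕ x → toℕ x < toℕ y → toℕ (σ y) < toℕ (σ x)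
      go _             atZero        _ ()
      go atZero        atPartner     _ _     = <-subst (sym (addCycle-partner τ s)) refl (s≤s z≤n)
      go atPartner     atPartner     _ s<s   = ⊥-elim (<-irrefl refl s<s)
      go (atPunched p) atPartner     _ _     = <-subst (sym (addCycle-partner τ s)) (sym (addCycle-punchIn τ s p)) (s≤s z≤n)
      go atZero        (atPunched q) _ _     =
        <-subst (sym (addCycle-punchIn τ s q)) refl (s≤s (subst (_< toℕ s) (sym (punchIn-fixes (τ q))) (below-s (τ q))))
      go atPartner     (atPunched q) _ s<q   = ⊥-elim (<-asym (≤-pred s<q) (subst (_< toℕ s) (sym (punchIn-fixes q)) (below-s q)))
      go (atPunched p) (atPunched q) start≤p p<q =
        <-subst (sym (addCycle-punchIn τ s q)) (sym (addCycle-punchIn τ s p))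
          (s≤s (punchIn-<-mono s (decreasing run p q (subst (suc n ∸ m ≤_) (punchIn-fixes p) (≤-pred start≤p))
                                                     (punchIn-<-cancel s (≤-pred p<q)))))
    ascent-σ : AscentAt σ (suc (n ∸ m))
    ascent-σ with p , q , p≡ , q≡ , τp<τq ← ascent run m≤n =
      suc (punchIn s p) , suc (punchIn s q) , cong suc (trans (punchIn-fixes p) p≡) , cong suc (trans (punchIn-fixes q) q≡) ,
      <-subst (sym (addCycle-punchIn τ s p)) (sym (addCycle-punchIn τ s q)) (s≤s (punchIn-<-mono s τp<τq))

  addCycle-opposite : ∀ {n} → addCycle (opposite {n}) (fromℕ n) ≗ opposite {suc (suc n)}
  addCycle-opposite {n} x with position (fromℕ n) x
  ... | atZero      = refl
  ... | atPartner   = toℕ-injective (trans (cong toℕ (addCycle-partner opposite (fromℕ n)))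
                        (sym (trans (opposite-prop (suc (fromℕ n))) (trans (cong (λ z → suc n ∸ suc z) (toℕ-fromℕ n)) (n∸n≡0 n)))))
  ... | atPunched p = toℕ-injective (begin
      toℕ (addCycle opposite (fromℕ n) (suc (punchIn (fromℕ n) p))) ≡⟨ cong toℕ (addCycle-punchIn opposite (fromℕ n) p) ⟩
      suc (toℕ (punchIn (fromℕ n) (opposite p)))                    ≡⟨ cong suc (punchIn-last (opposite p)) ⟩
      suc (toℕ (opposite p))                                        ≡⟨ cong suc (opposite-prop p) ⟩
      suc (n ∸ suc (toℕ p))                                         ≡⟨ suc-∸ n (suc (toℕ p)) (toℕ<n p) ⟨
      n ∸ toℕ p                                                      ≡⟨ cong (n ∸_) (punchIn-last p) ⟨
      n ∸ toℕ (punchIn (fromℕ n) p)                                 ≡⟨ opposite-prop (suc (punchIn (fromℕ n) p)) ⟨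
      toℕ (opposite (suc (punchIn (fromℕ n) p)))                    ∎)
    where
    open ≡-Reasoning
    punchIn-last : ∀ (q : Fin n) → toℕ (punchIn (fromℕ n) q) ≡ toℕ q
    punchIn-last q = punchIn-below (fromℕ n) q (subst (toℕ q <_) (sym (toℕ-fromℕ n)) (toℕ<n q))

-- coinv as a double sum, and its change under cycle insertion.
module Coinversions where

  open Counting
  open FiniteSums
  open Involutions
  open import Data.Nat using (ℕ; zero; suc; _+_; _∸_; _≤_; _<_; z≤n; s≤s; _<?_; _≤?_)
  open import Data.Nat.Properties using (≤-pred; <-irrefl; <-asym; +-identityʳ; +-0-commutativeMonoid)
  open import Data.Fin as Fin using (Fin; zero; suc; toℕ; punchIn; opposite)
  open import Data.List using (map; concatMap; allFin)
  open import Data.Product using (_×_; _,_; proj₁)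
  open import Algebra.Properties.CommutativeMonoid.Sum +-0-commutativeMonoid
    using (sum-cong-≗; sum-remove) renaming (sum to ∑)
  open import Relation.Binary.PropositionalEquality
    using (_≡_; _≗_; refl; sym; trans; cong; cong₂; subst; subst₂; module ≡-Reasoning)
  open ≡-Reasoning
  open import Relation.Nullary using (Dec; ¬_)
  open import Relation.Nullary.Decidable using (_×-dec_)
  open import Relation.Unary using (Decidable)

  coinversion? : ∀ {n} (σ : Perm n) (i j : Fin n) → Dec ((toℕ i < toℕ j) × (toℕ (σ i) < toℕ (σ j)))
  coinversion? σ i j = (toℕ i <? toℕ j) ×-dec (toℕ (σ i) <? toℕ (σ j))

  coinvFrom : ∀ {n} → Perm n → Fin n → ℕ
  coinvFrom σ i = ∑ (λ j → 𝟙 (coinversion? σ i j))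

  coinvSum : ∀ {n} → Perm n → ℕ
  coinvSum σ = ∑ (λ i → coinvFrom σ i)

  private
    count-pairs : ∀ {n} {Q : Fin n × Fin n → Set} (Q? : Decidable Q) →
                  count Q? (concatMap (λ i → map (λ j → (i , j)) (allFin n)) (allFin n)) ≡ ∑ (λ i → ∑ (λ j → 𝟙 (Q? (i , j))))
    count-pairs {n} Q? =
      trans (count-concatMap Q? (λ i → map (λ j → (i , j)) (allFin n)) (allFin n))
      (trans (sum-map-tabulate (λ i → i) (λ i → count Q? (map (λ j → (i , j)) (allFin n))))
             (sum-cong-≗ (λ i → trans (count-map Q? (λ j → (i , j)) (allFin n)) (count-tabulate (λ j → Q? (i , j)) (λ j → j)))))

  coinv≡coinvSum : ∀ {n} (σ : Perm n) → coinv σ ≡ coinvSum σ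
  coinv≡coinvSum {n} σ = trans (count-pairs {n} _) (sum-cong-≗ {n} (λ i → sum-cong-≗ {n} (λ j → 𝟙-cong _ _ (λ x → x) (λ x → x))))

  coinvSum-cong : ∀ {n} {σ σ′ : Perm n} → σ ≗ σ′ → coinvSum σ ≡ coinvSum σ′
  coinvSum-cong {n} σ≗σ′ = sum-cong-≗ {n} (λ i → sum-cong-≗ {n} (λ j → 𝟙-cong _ _
    (λ { (i<j , σi<σj) → i<j , <-subst (σ≗σ′ i) (σ≗σ′ j) σi<σj })
    (λ { (i<j , σi<σj) → i<j , <-subst (sym (σ≗σ′ i)) (sym (σ≗σ′ j)) σi<σj })))

  ∑-addCycle-split : ∀ {n} (s : Fin (suc n)) (f : Fin (suc (suc n)) → ℕ) →
                     ∑ f ≡ f zero + (f (suc s) + ∑ (λ p → f (suc (punchIn s p))))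
  ∑-addCycle-split s f = cong (f zero +_) (sum-remove {i = s} (λ p → f (suc p)))

  -- Adding the cycle (0 s+1) creates 2(n - s) coinversions: those of 0 and of
  -- s+1 with the n - s positions whose τ-values (resp. positions) lie beyond s.
  module _ {n} (τ : Perm n) (s : Fin (suc n)) (inv : IsInvolution τ) where
    private
      σ : Perm (suc (suc n))
      σ = addCycle τ s

      σ-partner : toℕ (σ (suc s)) ≡ 0
      σ-partner = cong toℕ (addCycle-partner τ s)

      σ-punchIn : ∀ p → toℕ (σ (suc (punchIn s p))) ≡ suc (toℕ (punchIn s (τ p)))
      σ-punchIn p = cong toℕ (addCycle-punchIn τ s p)

      -- Position 0 and value 0 (taken at s+1) never end a coinversion, so each
      -- row only counts the punched-in positions.
      row-split : ∀ i → coinvFrom σ i ≡ ∑ (λ q → 𝟙 (coinversion? σ i (suc (punchIn s q))))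
      row-split i = begin
        coinvFrom σ i
          ≡⟨ ∑-addCycle-split s (λ j → 𝟙 (coinversion? σ i j)) ⟩
        𝟙 (coinversion? σ i zero) + (𝟙 (coinversion? σ i (suc s)) + ∑ punched)
          ≡⟨ cong₂ _+_ into-zero (cong (_+ ∑ punched) into-partner) ⟩
        ∑ punched ∎
        where
        punched : Fin n → ℕ
        punched q = 𝟙 (coinversion? σ i (suc (punchIn s q)))
        into-zero : 𝟙 (coinversion? σ i zero) ≡ 0
        into-zero = 𝟙-no (coinversion? σ i zero) (λ { (() , _) })
        into-partner : 𝟙 (coinversion? σ i (suc s)) ≡ 0
        into-partner = 𝟙-no (coinversion? σ i (suc s)) (λ (_ , σi<0) → below-zero (subst (suc (toℕ (σ i)) ≤_) σ-partner σi<0))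
          where
          below-zero : ∀ {k} → ¬ (suc k ≤ 0)
          below-zero ()

      zero-punched : ∀ q → 𝟙 (coinversion? σ zero (suc (punchIn s q))) ≡ 𝟙 (toℕ s ≤? toℕ (τ q))
      zero-punched q = 𝟙-cong (coinversion? σ zero (suc (punchIn s q))) (toℕ s ≤? toℕ (τ q))
        (λ (_ , s<τq) → punchIn-beyond⁻ s (τ q) (≤-pred (subst (suc (toℕ s) <_) (σ-punchIn q) s<τq)))
        (λ s≤τq → s≤s z≤n , subst (suc (toℕ s) <_) (sym (σ-punchIn q)) (s≤s (punchIn-beyond s (τ q) s≤τq)))

      partner-punched : ∀ q → 𝟙 (coinversion? σ (suc s) (suc (punchIn s q))) ≡ 𝟙 (toℕ s ≤? toℕ q)
      partner-punched q = 𝟙-cong (coinversion? σ (suc s) (suc (punchIn s q))) (toℕ s ≤? toℕ q)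
        (λ (s<q , _) → punchIn-beyond⁻ s q (≤-pred s<q))
        (λ s≤q → s≤s (punchIn-beyond s q s≤q) , subst₂ _<_ (sym σ-partner) (sym (σ-punchIn q)) (s≤s z≤n))

      punched-punched : ∀ p q → 𝟙 (coinversion? σ (suc (punchIn s p)) (suc (punchIn s q))) ≡ 𝟙 (coinversion? τ p q)
      punched-punched p q = 𝟙-cong (coinversion? σ (suc (punchIn s p)) (suc (punchIn s q))) (coinversion? τ p q)
        (λ (p<q , σp<σq) → punchIn-<-cancel s (≤-pred p<q) ,
                            punchIn-<-cancel s (≤-pred (subst₂ _<_ (σ-punchIn p) (σ-punchIn q) σp<σq)))
        (λ (p<q , τp<τq) → s≤s (punchIn-<-mono s p<q) ,
                            subst₂ _<_ (sym (σ-punchIn p)) (sym (σ-punchIn q)) (s≤s (punchIn-<-mono s τp<τq)))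

    coinvSum-addCycle : coinvSum σ ≡ (n ∸ toℕ s) + ((n ∸ toℕ s) + coinvSum τ)
    coinvSum-addCycle = begin
      coinvSum σ
        ≡⟨ ∑-addCycle-split s (coinvFrom σ) ⟩
      coinvFrom σ zero + (coinvFrom σ (suc s) + ∑ (λ p → coinvFrom σ (suc (punchIn s p))))
        ≡⟨ cong₂ _+_ (trans (row-split zero) (sum-cong-≗ {n} zero-punched))
                     (cong₂ _+_ (trans (row-split (suc s)) (sum-cong-≗ {n} partner-punched))
                                (sum-cong-≗ {n} (λ p → trans (row-split (suc (punchIn s p))) (sum-cong-≗ {n} (punched-punched p))))) ⟩
      ∑ (λ q → beyond (τ q)) + (∑ beyond + coinvSum τ)
        ≡⟨ cong (_+ (∑ beyond + coinvSum τ)) (∑-involution τ inv beyond) ⟩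
      ∑ beyond + (∑ beyond + coinvSum τ)
        ≡⟨ cong₂ _+_ (count-≥ n (toℕ s)) (cong (_+ coinvSum τ) (count-≥ n (toℕ s))) ⟩
      (n ∸ toℕ s) + ((n ∸ toℕ s) + coinvSum τ) ∎
      where
      beyond : Fin n → ℕ
      beyond v = 𝟙 (toℕ s ≤? toℕ v)

  coinvSum-opposite : ∀ {n} → coinvSum (opposite {n}) ≡ 0
  coinvSum-opposite {n} = ∑-zero {n} _ (λ i → ∑-zero {n} _ (λ j →
    𝟙-no (coinversion? opposite i j) (λ { (i<j , σi<σj) → <-asym σi<σj (opposite-decreasing i j i<j) })))

  -- In 0 ⊕ opposite only the pairs (0, j) are coinversions.
  coinvSum-fixed : ∀ {m} → coinvSum (fixedThenDecreasing {m}) ≡ m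
  coinvSum-fixed {m} = trans (cong₂ _+_ from-zero (∑-zero {m} _ from-suc)) (+-identityʳ m)
    where
    from-zero : coinvFrom (fixedThenDecreasing {m}) zero ≡ m
    from-zero = cong₂ _+_ (𝟙-no (coinversion? (fixedThenDecreasing {m}) zero zero) (λ x → <-irrefl refl (proj₁ x)))
                  (∑-one {m} _ (λ q → 𝟙-yes (coinversion? fixedThenDecreasing zero (suc q)) (s≤s z≤n , s≤s z≤n)))
    from-suc : ∀ p → coinvFrom (fixedThenDecreasing {m}) (suc p) ≡ 0
    from-suc p = cong₂ _+_ (𝟙-no (coinversion? fixedThenDecreasing (suc p) zero) (λ { (() , _) }))
                   (∑-zero {m} _ (λ q → 𝟙-no (coinversion? fixedThenDecreasing (suc p) (suc q))
                     (λ { (s≤s p<q , s≤s σp<σq) → <-asym σp<σq (opposite-decreasing p q p<q) })))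

-- The sequences of A_{m,ℓ} and B_{m,ℓ} described by a recursion on the first entry.
module Sequences where

  open import Data.Nat using (ℕ; zero; suc; _+_; _∸_; _≤_; z≤n; s≤s; _≟_)
  open import Data.Nat.Properties
    using (≤-refl; ≤-trans; ≤-pred; n≤1+n; m≤m+n; +-suc; +-comm; +-assoc; +-identityʳ; +-monoˡ-≤; m+n∸m≡n)
  open import Data.Fin using (Fin; zero; suc; toℕ)
  open import Data.List using (List; []; _∷_; _++_; tabulate; reverse; map; [_])
  open import Data.List.Properties using (unfold-reverse; reverse-map; map-tabulate)
  open import Data.List.Relation.Binary.Permutation.Propositional.Properties using (↭-reverse)
  open import Data.Nat.ListAction using (sum)
  open import Data.Nat.ListAction.Properties using (sum-↭)
  open import Data.Product using (_×_; _,_)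
  open import Data.Unit using (⊤; tt)
  open import Data.Empty using (⊥-elim)
  open import Relation.Binary.PropositionalEquality using (_≡_; _≢_; refl; sym; trans; cong; subst)
  open import Relation.Nullary using (yes; no)

  -- The final run after an insertion with parameter a into a permutation with
  -- final run m: an insertion at the last place (a = 1) prolongs the run, any
  -- other insertion starts a new run of length a - 1.
  nextRun : ℕ → ℕ → ℕ
  nextRun m (suc zero) = suc m
  nextRun m a          = a

  nextRun-≢1 : ∀ m a → a ≢ 1 → nextRun m a ≡ a
  nextRun-≢1 m zero          _   = refl
  nextRun-≢1 m (suc zero)    a≢1 = ⊥-elim (a≢1 refl)
  nextRun-≢1 m (suc (suc a)) _   = refl

  nextRun-≤ : ∀ m a → a ≤ m → nextRun m a ≤ suc m
  nextRun-≤ m zero          _   = z≤n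
  nextRun-≤ m (suc zero)    _   = ≤-refl
  nextRun-≤ m (suc (suc a)) a≤m = ≤-trans a≤m (n≤1+n m)

  -- Admissible m (a₁ ∷ … ∷ a_ℓ): every aᵢ lies between 1 and the final run
  -- reached after the earlier insertions.  This is A_{m,ℓ} read recursively.
  Admissible : ℕ → List ℕ → Set
  Admissible m []       = ⊤
  Admissible m (a ∷ as) = (1 ≤ a) × (a ≤ m) × Admissible (nextRun m a) as

  -- The same condition for a sequence listed from its last insertion backwards,
  -- the order in which a code is decoded.
  runAfter : ℕ → List ℕ → ℕ
  runAfter m []       = m
  runAfter m (r ∷ rs) = nextRun (runAfter m rs) r

  AdmissibleRev : ℕ → List ℕ → Set
  AdmissibleRev m []       = ⊤
  AdmissibleRev m (r ∷ rs) = AdmissibleRev m rs × (1 ≤ r) × (r ≤ runAfter m rs)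

  private
    runAfter-snoc : ∀ m a rs → runAfter m (rs ++ [ a ]) ≡ runAfter (nextRun m a) rs
    runAfter-snoc m a []       = refl
    runAfter-snoc m a (r ∷ rs) = cong (λ z → nextRun z r) (runAfter-snoc m a rs)

    admissibleRev-snoc⁺ : ∀ m a rs → 1 ≤ a → a ≤ m → AdmissibleRev (nextRun m a) rs → AdmissibleRev m (rs ++ [ a ])
    admissibleRev-snoc⁺ m a []       1≤a a≤m _                    = tt , 1≤a , a≤m
    admissibleRev-snoc⁺ m a (r ∷ rs) 1≤a a≤m (adm , 1≤r , r≤run) =
      admissibleRev-snoc⁺ m a rs 1≤a a≤m adm , 1≤r , subst (r ≤_) (sym (runAfter-snoc m a rs)) r≤run

    admissibleRev-snoc⁻ : ∀ m a rs → AdmissibleRev m (rs ++ [ a ]) → (1 ≤ a) × (a ≤ m) × AdmissibleRev (nextRun m a) rs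
    admissibleRev-snoc⁻ m a []       (_ , 1≤a , a≤m)     = 1≤a , a≤m , tt
    admissibleRev-snoc⁻ m a (r ∷ rs) (adm , 1≤r , r≤run)
      with 1≤a , a≤m , adm′ ← admissibleRev-snoc⁻ m a rs adm =
      1≤a , a≤m , adm′ , 1≤r , subst (r ≤_) (runAfter-snoc m a rs) r≤run

  admissible⇒rev : ∀ m as → Admissible m as → AdmissibleRev m (reverse as)
  admissible⇒rev m []       _                  = tt
  admissible⇒rev m (a ∷ as) (1≤a , a≤m , adm) = subst (AdmissibleRev m) (sym (unfold-reverse a as))
    (admissibleRev-snoc⁺ m a (reverse as) 1≤a a≤m (admissible⇒rev (nextRun m a) as adm))

  rev⇒admissible : ∀ m as → AdmissibleRev m (reverse as) → Admissible m as
  rev⇒admissible m []       _   = tt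
  rev⇒admissible m (a ∷ as) adm
    with 1≤a , a≤m , adm′ ← admissibleRev-snoc⁻ m a (reverse as) (subst (AdmissibleRev m) (unfold-reverse a as) adm) =
    1≤a , a≤m , rev⇒admissible (nextRun m a) as adm′

  HeadNotOne : List ℕ → Set
  HeadNotOne []       = ⊤
  HeadNotOne (a ∷ as) = a ≢ 1

  LastNotOne : List ℕ → Set
  LastNotOne []            = ⊤
  LastNotOne (r ∷ [])      = r ≢ 1
  LastNotOne (r ∷ r′ ∷ rs) = LastNotOne (r′ ∷ rs)

  lastNotOne-tail : ∀ r rs → LastNotOne (r ∷ rs) → LastNotOne rs
  lastNotOne-tail r []        _   = tt
  lastNotOne-tail r (r′ ∷ rs) ok = ok

  private
    lastNotOne-snoc⁺ : ∀ a xs → a ≢ 1 → LastNotOne (xs ++ [ a ])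
    lastNotOne-snoc⁺ a []           a≢1 = a≢1
    lastNotOne-snoc⁺ a (x ∷ [])     a≢1 = a≢1
    lastNotOne-snoc⁺ a (x ∷ y ∷ xs) a≢1 = lastNotOne-snoc⁺ a (y ∷ xs) a≢1

    lastNotOne-snoc⁻ : ∀ a xs → LastNotOne (xs ++ [ a ]) → a ≢ 1
    lastNotOne-snoc⁻ a []           ok = ok
    lastNotOne-snoc⁻ a (x ∷ [])     ok = ok
    lastNotOne-snoc⁻ a (x ∷ y ∷ xs) ok = lastNotOne-snoc⁻ a (y ∷ xs) ok

  headNotOne⇒last : ∀ as → HeadNotOne as → LastNotOne (reverse as)
  headNotOne⇒last []       _   = tt
  headNotOne⇒last (a ∷ as) a≢1 = subst LastNotOne (sym (unfold-reverse a as)) (lastNotOne-snoc⁺ a (reverse as) a≢1)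

  lastNotOne⇒head : ∀ as → LastNotOne (reverse as) → HeadNotOne as
  lastNotOne⇒head []       _  = tt
  lastNotOne⇒head (a ∷ as) ok = lastNotOne-snoc⁻ a (reverse as) (subst LastNotOne (unfold-reverse a as) ok)

  -- Conditions (2) and (3) for the tail are
  -- conditions (2) (if a₁ = 1) resp. (3) (if a₁ ≠ 1) for the whole sequence.
  module _ {m ℓ : ℕ} {f : Fin (suc ℓ) → ℕ} where
    private
      tail : Fin ℓ → ℕ
      tail p = f (suc p)

    inA-uncons : InA m (suc ℓ) f → (1 ≤ f zero) × (f zero ≤ m) × InA (nextRun m (f zero)) ℓ tail
    inA-uncons a∈A = InA.positive a∈A zero , InA.cond1 a∈A zero refl , tail∈A
      where
      open InA a∈A
      tail∈A : InA (nextRun m (f zero)) ℓ tail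
      InA.positive tail∈A p = positive (suc p)
      InA.cond1 tail∈A zero _ with f zero ≟ 1
      ... | yes a₁≡1 = subst (λ z → f (suc zero) ≤ nextRun m z) (sym a₁≡1) (subst (f (suc zero) ≤_) (+-comm m 1)
                         (cond2 (suc zero) (λ { zero _ → a₁≡1 ; (suc t) (s≤s ()) })))
      ... | no  a₁≢1 = subst (f (suc zero) ≤_) (trans (+-identityʳ (f zero)) (sym (nextRun-≢1 m (f zero) a₁≢1)))
                         (cond3 zero (suc zero) (s≤s z≤n) a₁≢1 (λ { zero () _ ; (suc t) _ (s≤s ()) }))
      InA.cond1 tail∈A (suc p) ()
      InA.cond2 tail∈A p ones with f zero ≟ 1
      ... | yes a₁≡1 = subst (λ z → f (suc p) ≤ nextRun m z + toℕ p) (sym a₁≡1) (subst (f (suc p) ≤_) (+-suc m (toℕ p))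
                         (cond2 (suc p) (λ { zero _ → a₁≡1 ; (suc t) t<p → ones t (≤-pred t<p) })))
      ... | no  a₁≢1 = subst (λ z → f (suc p) ≤ z + toℕ p) (sym (nextRun-≢1 m (f zero) a₁≢1))
                         (cond3 zero (suc p) (s≤s z≤n) a₁≢1 (λ { zero () _ ; (suc t) _ t<p → ones t (≤-pred t<p) }))
      InA.cond3 tail∈A i p i<p aᵢ≢1 ones =
        cond3 (suc i) (suc p) (s≤s i<p) aᵢ≢1 (λ { zero () _ ; (suc t) i<t t<p → ones t (≤-pred i<t) (≤-pred t<p) })

    inA-cons : 1 ≤ f zero → f zero ≤ m → InA (nextRun m (f zero)) ℓ tail → InA m (suc ℓ) f
    InA.positive (inA-cons 1≤a₁ _ tail∈A) zero    = 1≤a₁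
    InA.positive (inA-cons _ _ tail∈A)    (suc p) = InA.positive tail∈A p
    InA.cond1 (inA-cons _ a₁≤m _) zero    _  = a₁≤m
    InA.cond1 (inA-cons _ _ _)    (suc p) ()
    InA.cond2 (inA-cons _ a₁≤m _) zero _ = subst (f zero ≤_) (sym (+-identityʳ m)) a₁≤m
    InA.cond2 (inA-cons _ _ tail∈A) (suc p) ones =
      subst (f (suc p) ≤_) (sym (+-suc m (toℕ p)))
        (subst (λ z → f (suc p) ≤ nextRun m z + toℕ p) (ones zero (s≤s z≤n))
          (InA.cond2 tail∈A p (λ t t<p → ones (suc t) (s≤s t<p))))
    InA.cond3 (inA-cons _ _ _) zero    zero () _ _
    InA.cond3 (inA-cons _ _ _) (suc i) zero () _ _
    InA.cond3 (inA-cons _ _ tail∈A) zero (suc p) _ a₁≢1 ones =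
      subst (λ z → f (suc p) ≤ z + toℕ p) (nextRun-≢1 m (f zero) a₁≢1)
        (InA.cond2 tail∈A p (λ t t<p → ones (suc t) (s≤s z≤n) (s≤s t<p)))
    InA.cond3 (inA-cons _ _ tail∈A) (suc i) (suc p) (s≤s i<p) aᵢ≢1 ones =
      InA.cond3 tail∈A i p i<p aᵢ≢1 (λ t i<t t<p → ones (suc t) (s≤s i<t) (s≤s t<p))

  inA⇒admissible : ∀ m ℓ (f : Fin ℓ → ℕ) → InA m ℓ f → Admissible m (tabulate f)
  inA⇒admissible m zero    f _   = tt
  inA⇒admissible m (suc ℓ) f a∈A with 1≤a₁ , a₁≤m , tail∈A ← inA-uncons a∈A =
    1≤a₁ , a₁≤m , inA⇒admissible (nextRun m (f zero)) ℓ (λ p → f (suc p)) tail∈A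

  admissible⇒inA : ∀ m ℓ (f : Fin ℓ → ℕ) → Admissible m (tabulate f) → InA m ℓ f
  admissible⇒inA m zero    f _ = record { positive = λ () ; cond1 = λ () ; cond2 = λ () ; cond3 = λ () }
  admissible⇒inA m (suc ℓ) f (1≤a₁ , a₁≤m , adm) =
    inA-cons 1≤a₁ a₁≤m (admissible⇒inA (nextRun m (f zero)) ℓ (λ p → f (suc p)) adm)

  inA-bound : ∀ m ℓ (f : Fin ℓ → ℕ) → InA m ℓ f → ∀ p → f p ≤ m + ℓ
  inA-bound m (suc ℓ) f a∈A zero    = ≤-trans (InA.cond1 a∈A zero refl) (m≤m+n m (suc ℓ))
  inA-bound m (suc ℓ) f a∈A (suc p) with _ , a₁≤m , tail∈A ← inA-uncons a∈A =
    ≤-trans (inA-bound (nextRun m (f zero)) ℓ (λ p → f (suc p)) tail∈A p)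
            (subst (nextRun m (f zero) + ℓ ≤_) (sym (+-suc m ℓ)) (+-monoˡ-≤ ℓ (nextRun-≤ m (f zero) a₁≤m)))

  inB⇒headNotOne : ∀ m ℓ (f : Fin ℓ → ℕ) → InB m ℓ f → HeadNotOne (tabulate f)
  inB⇒headNotOne m zero    f _           = tt
  inB⇒headNotOne m (suc ℓ) f (_ , a₁≢1) = a₁≢1 zero refl

  headNotOne⇒inB : ∀ m ℓ (f : Fin ℓ → ℕ) → InA m ℓ f → HeadNotOne (tabulate f) → InB m ℓ f
  headNotOne⇒inB m zero    f a∈A _   = a∈A , λ ()
  headNotOne⇒inB m (suc ℓ) f a∈A a₁≢1 = a∈A , λ { zero _ → a₁≢1 ; (suc p) () }

  excess : List ℕ → ℕ
  excess rs = sum (map (_∸ 1) rs)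

  private
    sum-tabulate-positive : ∀ ℓ (f : Fin ℓ → ℕ) → (∀ p → 1 ≤ f p) → sum (tabulate f) ≡ ℓ + excess (tabulate f)
    sum-tabulate-positive zero    f _   = refl
    sum-tabulate-positive (suc ℓ) f pos with f zero | pos zero
    ... | suc a | s≤s _ = cong suc (trans (cong (a +_) (sum-tabulate-positive ℓ (λ p → f (suc p)) (λ p → pos (suc p))))
          (trans (sym (+-assoc a ℓ _)) (trans (cong (_+ excess (tabulate (λ p → f (suc p)))) (+-comm a ℓ)) (+-assoc ℓ a _))))

  weight≡excess : ∀ ℓ (f : Fin ℓ → ℕ) → (∀ p → 1 ≤ f p) → weight f ≡ excess (reverse (tabulate f))
  weight≡excess ℓ f pos =
    trans (cong (_∸ ℓ) (trans (cong sum (map-tabulate (λ i → i) f)) (sum-tabulate-positive ℓ f pos)))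
    (trans (m+n∸m≡n ℓ _)
    (sym (trans (cong sum (reverse-map (_∸ 1) (tabulate f))) (sum-↭ (↭-reverse (map (_∸ 1) (tabulate f)))))))

-- Codes and the bijection decode between valid codes of size 2k and I_{2k}(123).
module Encoding where

  open Involutions
  open Coinversions
  open Sequences
  open import Data.Nat using (ℕ; zero; suc; _+_; _*_; _∸_; _≤_; _<_; z≤n; s≤s)
  open import Data.Nat.Properties
    using (≤-refl; ≤-trans; ≤-reflexive; ≤-pred; ≤-antisym; <-≤-trans; n≤1+n; +-suc; +-comm; m∸n≤m;
           m∸[m∸n]≡n; ∸-monoˡ-≤; ∸-monoʳ-<; ∸-cancelˡ-≡; m∸n≡0⇒m≤n; n<1⇒n≡0)
  open import Data.Fin using (Fin; zero; suc; toℕ; opposite; fromℕ<; fromℕ)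
  open import Data.Fin.Properties using (0≢1+n; toℕ-fromℕ<; toℕ-injective; toℕ-fromℕ; toℕ<n; opposite-involutive)
  open import Data.List using (List; []; _∷_)
  open import Data.Product using (Σ; _×_; _,_; proj₁; proj₂)
  import Data.Nat.Properties as ℕₚ
  open import Data.Sum using (_⊎_; inj₁; inj₂)
  open import Data.Unit using (tt)
  open import Data.Empty using (⊥-elim)
  open import Relation.Binary.PropositionalEquality using (_≡_; _≢_; _≗_; refl; sym; trans; cong; cong₂; subst)

  -- The two kinds of involutions that remain when all 2-cycles through the
  -- first position have been removed: the reversal of [2j] (leading to the
  -- B-polynomials) and 0 ⊕ reversal of [2j-1] (leading to the A-polynomials).
  data Base : Set where
    reversal fixed : Base

  -- A code: start from the base involution of [2j] and insert 2-cycles with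
  -- parameters r₁, …, r_ℓ; the list params = r_ℓ ∷ … ∷ r₁ starts with the last one.
  record Code : Set where
    constructor code
    field
      height : ℕ
      base   : Base
      params : List ℕ

  -- 2k by a recursion that matches the two-step growth of code sizes
  double : ℕ → ℕ
  double zero    = 0
  double (suc k) = suc (suc (double k))

  double≡2* : ∀ k → double k ≡ 2 * k
  double≡2* zero    = refl
  double≡2* (suc k) = cong suc (trans (cong suc (double≡2* k)) (sym (+-suc k (k + 0))))

  private
    suc-suc-injective : ∀ {a b} → 2 + a ≡ 2 + b → a ≡ b
    suc-suc-injective refl = refl

  double-injective : ∀ {a b} → double a ≡ double b → a ≡ b
  double-injective {zero}  {zero}  _    = refl
  double-injective {suc a} {suc b} same = cong suc (double-injective (suc-suc-injective same))

  codeSize : ℕ → List ℕ → ℕ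
  codeSize j []       = double j
  codeSize j (r ∷ rs) = suc (suc (codeSize j rs))

  startRun : Base → ℕ → ℕ
  startRun fixed    j = 2 * j
  startRun reversal j = 2 * j + 1

  baseCoinv : Base → ℕ → ℕ
  baseCoinv fixed    j = 2 * j ∸ 1
  baseCoinv reversal j = 0

  codeCoinv : Code → ℕ
  codeCoinv (code j g [])       = baseCoinv g j
  codeCoinv (code j g (r ∷ rs)) = (r ∸ 1) + ((r ∸ 1) + codeCoinv (code j g rs))

  cycleStart : (n r : ℕ) → Fin (suc n)
  cycleStart n r = fromℕ< (s≤s (m∸n≤m n (r ∸ 1)))

  cycleStart≡ : ∀ n r → toℕ (cycleStart n r) ≡ n ∸ (r ∸ 1)
  cycleStart≡ n r = toℕ-fromℕ< (s≤s (m∸n≤m n (r ∸ 1)))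

  basePerm : Base → (n : ℕ) → Perm n
  basePerm fixed    zero    = λ ()
  basePerm fixed    (suc m) = fixedThenDecreasing
  basePerm reversal n       = opposite

  -- decode n c is meaningful when n is the size of c (see Valid)
  decode : (n : ℕ) → Code → Perm n
  decode n             (code j g [])       = basePerm g n
  decode (suc (suc n)) (code j g (r ∷ rs)) = addCycle (decode n (code j g rs)) (cycleStart n r)
  decode zero          (code j g (r ∷ rs)) = λ x → x
  decode (suc zero)    (code j g (r ∷ rs)) = λ x → x

  -- The codes of size n: every parameter is admissible for the final run it
  -- is inserted into, and no insertion at the last place directly follows the
  -- reversal (that would just be a larger reversal).
  record Valid (n : ℕ) (c : Code) : Set where
    constructor valid
    open Code c
    field
      height≥1    : 1 ≤ height
      size≡       : n ≡ codeSize height params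
      admissible  : AdmissibleRev (startRun base height) params
      noLastPlace : base ≡ reversal → LastNotOne params

  module _ {n : ℕ} {τ : Perm n} {m : ℕ} (run : FinalRun τ m) {r : ℕ} (1≤r : 1 ≤ r) (r≤m : r ≤ m) where
    private
      s : Fin (suc n)
      s = cycleStart n r
      r-1≤n : r ∸ 1 ≤ n
      r-1≤n = ∸-monoˡ-≤ 1 (≤-trans r≤m (bounded run))

    cycleStart-gap : n ∸ toℕ s ≡ r ∸ 1
    cycleStart-gap = trans (cong (n ∸_) (cycleStart≡ n r)) (m∸[m∸n]≡n r-1≤n)

    admissible⇒decreasing : DecreasingFrom τ (toℕ s)
    admissible⇒decreasing =
      proj₂ (decreasingFrom⇔ run (toℕ s) (subst (_≤ n) (sym (cycleStart≡ n r)) (m∸n≤m n (r ∸ 1))))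
        (subst (_< m) (sym cycleStart-gap) (<-≤-trans (∸-monoʳ-< {r} {1} {0} (s≤s z≤n) 1≤r) r≤m))

    finalRun-insert : (r ≡ 1 → m ≤ n) → FinalRun (addCycle τ s) (nextRun m r)
    finalRun-insert m≤n = insert r 1≤r r≤m m≤n refl
      where
      insert : ∀ r′ → 1 ≤ r′ → r′ ≤ m → (r′ ≡ 1 → m ≤ n) → r′ ≡ r → FinalRun (addCycle τ s) (nextRun m r′)
      insert (suc zero)     _ _      m≤n refl = finalRun-addCycle-last τ s m (trans (cycleStart≡ n 1) refl) run (m≤n refl)
      insert (suc (suc r′)) _ r′+2≤m _   refl =
        subst (FinalRun (addCycle τ s)) run≡ (finalRun-addCycle-inner τ s s<n admissible⇒decreasing)
        where
        r′+1≤n : suc r′ ≤ n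
        r′+1≤n = ≤-pred (≤-trans r′+2≤m (bounded run))
        run≡ : suc (n ∸ toℕ s) ≡ suc (suc r′)
        run≡ = cong suc cycleStart-gap
        s<n : toℕ s < n
        s<n = subst (_< n) (sym (cycleStart≡ n (suc (suc r′)))) (∸-monoʳ-< {n} {suc r′} {0} (s≤s z≤n) r′+1≤n)

  record Sound {n} (σ : Perm n) (c : Code) : Set where
    open Code c
    field
      involution : IsInvolution σ
      avoids     : Avoids123 σ
      run        : FinalRun σ (runAfter (startRun base height) params)
      coinvSum≡  : coinvSum σ ≡ codeCoinv c
      runBound   : runAfter (startRun base height) params ≤ n ⊎ (params ≡ [] × base ≡ reversal)
  open Sound

  sound : ∀ {n} j g rs → Valid n (code j g rs) → Sound (decode n (code j g rs)) (code j g rs)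
  sound (suc j) fixed [] (valid _ refl _ _) = record
    { involution = fixedThenDecreasing-involution
    ; avoids     = fixedThenDecreasing-avoids
    ; run        = subst (FinalRun fixedThenDecreasing) (double≡2* (suc j)) finalRun-fixed
    ; coinvSum≡  = trans coinvSum-fixed (cong (_∸ 1) (double≡2* (suc j)))
    ; runBound   = inj₁ (≤-reflexive (sym (double≡2* (suc j))))
    }
  sound j reversal [] (valid _ refl _ _) = record
    { involution = opposite-involutive
    ; avoids     = opposite-avoids
    ; run        = subst (FinalRun opposite) (trans (cong suc (double≡2* j)) (+-comm 1 (2 * j))) finalRun-opposite
    ; coinvSum≡  = coinvSum-opposite {double j}
    ; runBound   = inj₂ (refl , refl)
    }
  sound j g (r ∷ rs) (valid j≥1 refl (adm , 1≤r , r≤m) noLast) = record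
    { involution = addCycle-involution τ s (involution τ-sound)
    ; avoids     = addCycle-avoids τ s (involution τ-sound) (avoids τ-sound) decreasing-from-s
    ; run        = finalRun-insert (run τ-sound) 1≤r r≤m run≤size
    ; coinvSum≡  = trans (coinvSum-addCycle τ s (involution τ-sound))
                         (cong₂ _+_ gap (cong₂ _+_ gap (coinvSum≡ τ-sound)))
    ; runBound   = inj₁ (nextRun-bound r r≤m)
    }
    where
    n′ : ℕ
    n′ = codeSize j rs
    τ : Perm n′
    τ = decode n′ (code j g rs)
    τ-sound : Sound τ (code j g rs)
    τ-sound = sound j g rs (valid j≥1 refl adm (λ g≡rev → lastNotOne-tail r rs (noLast g≡rev)))
    m : ℕ
    m = runAfter (startRun g j) rs
    s : Fin (suc n′)
    s = cycleStart n′ r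
    gap : n′ ∸ toℕ s ≡ r ∸ 1
    gap = cycleStart-gap (run τ-sound) 1≤r r≤m
    decreasing-from-s : DecreasingFrom τ (toℕ s)
    decreasing-from-s = admissible⇒decreasing (run τ-sound) 1≤r r≤m
    -- an insertion at the last place never directly follows a bare reversal
    run≤size : r ≡ 1 → m ≤ n′
    run≤size r≡1 with runBound τ-sound
    ... | inj₁ m≤n′          = m≤n′
    ... | inj₂ (refl , refl) = ⊥-elim (noLast refl r≡1)
    nextRun-bound : ∀ r′ → r′ ≤ m → nextRun m r′ ≤ suc (suc n′)
    nextRun-bound zero           _     = z≤n
    nextRun-bound (suc zero)     _     = s≤s (bounded (run τ-sound))
    nextRun-bound (suc (suc r′)) r′≤m = ≤-trans r′≤m (≤-trans (bounded (run τ-sound)) (n≤1+n (suc n′)))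

  tailValid : ∀ {n j g r rs} → Valid (suc (suc n)) (code j g (r ∷ rs)) → Valid n (code j g rs)
  tailValid {r = r} {rs} (valid j≥1 size≡ (adm , _) noLast) =
    valid j≥1 (suc-suc-injective size≡) adm (λ g≡rev → lastNotOne-tail r rs (noLast g≡rev))

  param≥1 : ∀ {n j g r rs} → Valid n (code j g (r ∷ rs)) → 1 ≤ r
  param≥1 v = proj₁ (proj₂ (Valid.admissible v))

  paramBound : ∀ {n j g r rs} → Valid (suc (suc n)) (code j g (r ∷ rs)) → r ∸ 1 ≤ n
  paramBound {j = j} {g} {r} {rs} v@(valid _ refl (_ , _ , r≤m) _) =
    ∸-monoˡ-≤ 1 (≤-trans r≤m (bounded (run (sound j g rs (tailValid v)))))

  cycleStart-injective : ∀ {n r r′} → 1 ≤ r → 1 ≤ r′ → r ∸ 1 ≤ n → r′ ∸ 1 ≤ n →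
                         cycleStart n r ≡ cycleStart n r′ → r ≡ r′
  cycleStart-injective {n} {suc r} {suc r′} _ _ r≤n r′≤n same =
    cong suc (∸-cancelˡ-≡ r≤n r′≤n (trans (sym (cycleStart≡ n (suc r))) (trans (cong toℕ same) (cycleStart≡ n (suc r′)))))

  cycleStart-last : ∀ n → cycleStart n 1 ≡ fromℕ n
  cycleStart-last n = toℕ-injective (trans (cycleStart≡ n 1) (sym (toℕ-fromℕ n)))

  -- Only the bare reversal code decodes to the reversal; this is why
  -- LastNotOne is imposed on reversal codes.
  reversal-unique : ∀ n c → Valid n c → decode n c ≗ opposite → Code.params c ≡ [] × Code.base c ≡ reversal
  reversal-unique n (code zero fixed []) (valid () _ _ _) _
  reversal-unique n (code (suc j) fixed []) (valid _ refl _ _) same = ⊥-elim (0≢1+n (same zero))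
  reversal-unique n (code j reversal []) _ _ = refl , refl
  reversal-unique zero (code j g (r ∷ rs)) (valid _ () _ _) _
  reversal-unique (suc zero) (code j g (r ∷ rs)) (valid _ () _ _) _
  reversal-unique (suc (suc n)) (code j g (r ∷ rs)) v same
    with s≡last , τ≗ ← addCycle-injective _ opposite (cycleStart n r) (fromℕ n) (λ x → trans (same x) (sym (addCycle-opposite x)))
    with refl , refl ← reversal-unique n (code j g rs) (tailValid v) τ≗ =
    ⊥-elim (Valid.noLastPlace v refl (cycleStart-injective (param≥1 v) (s≤s z≤n)
             (paramBound v) z≤n (trans s≡last (sym (cycleStart-last n)))))

  decode-injective : ∀ n c₁ c₂ → Valid n c₁ → Valid n c₂ → decode n c₁ ≗ decode n c₂ → c₁ ≡ c₂
  decode-injective n (code j₁ g₁ rs₁) (code j₂ reversal []) v₁ v₂ same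
    with refl , refl ← reversal-unique n (code j₁ g₁ rs₁) v₁ same =
    cong (λ j → code j reversal []) (double-injective (trans (sym (Valid.size≡ v₁)) (Valid.size≡ v₂)))
  decode-injective n (code j₁ reversal []) (code j₂ g₂ rs₂) v₁ v₂ same
    with refl , refl ← reversal-unique n (code j₂ g₂ rs₂) v₂ (λ x → sym (same x)) =
    cong (λ j → code j reversal []) (double-injective (trans (sym (Valid.size≡ v₁)) (Valid.size≡ v₂)))
  decode-injective n (code j₁ fixed []) (code j₂ fixed []) v₁ v₂ _ =
    cong (λ j → code j fixed []) (double-injective (trans (sym (Valid.size≡ v₁)) (Valid.size≡ v₂)))
  decode-injective n (code zero fixed []) _ (valid () _ _ _) _ _
  decode-injective n (code (suc j₁) fixed []) (code j₂ g₂ (r ∷ rs)) (valid _ refl _ _) _ same = ⊥-elim (0≢1+n (same zero))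
  decode-injective n _ (code zero fixed []) _ (valid () _ _ _) _
  decode-injective n (code j₁ g₁ (r ∷ rs)) (code (suc j₂) fixed []) _ (valid _ refl _ _) same = ⊥-elim (0≢1+n (sym (same zero)))
  decode-injective zero       (code _ _ (_ ∷ _)) _ (valid _ () _ _) _ _
  decode-injective (suc zero) (code _ _ (_ ∷ _)) _ (valid _ () _ _) _ _
  decode-injective (suc (suc n)) (code j₁ g₁ (r₁ ∷ rs₁)) (code j₂ g₂ (r₂ ∷ rs₂)) v₁ v₂ same
    with s≡ , τ≗ ← addCycle-injective _ _ (cycleStart n r₁) (cycleStart n r₂) same
    with refl ← decode-injective n (code j₁ g₁ rs₁) (code j₂ g₂ rs₂) (tailValid v₁) (tailValid v₂) τ≗ =
    cong (λ r → code j₁ g₁ (r ∷ rs₁))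
         (cycleStart-injective (param≥1 v₁) (param≥1 v₂) (paramBound v₁) (paramBound v₂) s≡)

  -- Inserting a cycle into a decoded map at a position from which it is
  -- decreasing is again decoded from a valid code: append the parameter
  -- r = n - s + 1, except that the reversal just grows when r = 1.
  module _ {n} {τ : Perm n} (s : Fin (suc n)) (decreasing : DecreasingFrom τ (toℕ s)) where
    private
      r : ℕ
      r = suc (n ∸ toℕ s)
      s≤n : toℕ s ≤ n
      s≤n = ≤-pred (toℕ<n s)
      cycleStart-r : cycleStart n r ≡ s
      cycleStart-r = toℕ-injective (trans (cycleStart≡ n r) (m∸[m∸n]≡n s≤n))

      appendParam : ∀ j g rs → Valid n (code j g rs) → decode n (code j g rs) ≗ τ → (g ≡ reversal → LastNotOne (r ∷ rs)) →
                    Σ Code λ c → Valid (suc (suc n)) c × decode (suc (suc n)) c ≗ addCycle τ s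
      appendParam j g rs v decode≗τ noLast =
        code j g (r ∷ rs) ,
        valid (Valid.height≥1 v) (cong (2 +_) (Valid.size≡ v)) (Valid.admissible v , s≤s z≤n , r≤m) noLast ,
        λ x → trans (addCycle-cong (cycleStart n r) decode≗τ x) (cong (λ z → addCycle τ z x) cycleStart-r)
        where
        run-τ : FinalRun τ (runAfter (startRun g j) rs)
        run-τ = finalRun-resp decode≗τ (Sound.run (sound j g rs v))
        r≤m : r ≤ runAfter (startRun g j) rs
        r≤m = proj₁ (decreasingFrom⇔ run-τ (toℕ s) s≤n) decreasing

    encode-addCycle : ∀ c → Valid n c → decode n c ≗ τ →
                      Σ Code λ c′ → Valid (suc (suc n)) c′ × decode (suc (suc n)) c′ ≗ addCycle τ s
    encode-addCycle (code j fixed rs)           v decode≗τ = appendParam j fixed rs v decode≗τ (λ ())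
    encode-addCycle (code j reversal (r′ ∷ rs)) v decode≗τ = appendParam j reversal (r′ ∷ rs) v decode≗τ (Valid.noLastPlace v)
    encode-addCycle (code j reversal [])        v decode≗τ with n ∸ toℕ s in gap
    ... | suc _ = appendParam j reversal [] v decode≗τ (λ _ r≡1 → ℕₚ.0≢1+n (trans (sym (ℕₚ.suc-injective r≡1)) gap))
    ... | zero  = code (suc j) reversal [] , valid (s≤s z≤n) (cong (2 +_) (Valid.size≡ v)) tt (λ _ → tt) ,
                  λ x → trans (sym (addCycle-opposite x)) (trans (addCycle-cong (fromℕ n) decode≗τ x) (cong (λ z → addCycle τ z x) last≡s))
      where
      last≡s : fromℕ n ≡ s
      last≡s = toℕ-injective (trans (toℕ-fromℕ n) (≤-antisym (m∸n≡0⇒m≤n gap) s≤n))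

  -- Every 123-avoiding involution of [2k+2] is decoded from a valid code:
  -- peel off the cycle through 0 until 0 is a fixed point or only [2] is left.
  encode : ∀ k (σ : Perm (double (suc k))) → IsInvolution σ → Avoids123 σ →
           Σ Code λ c → Valid (double (suc k)) c × decode (double (suc k)) c ≗ σ
  encode k σ inv avoids with σ zero in σ0
  ... | zero = code (suc k) fixed [] , valid (s≤s z≤n) refl tt (λ ()) , λ x → sym (fixedHead σ inv avoids σ0 x)
  encode zero σ inv avoids | suc s =
    code 1 reversal [] , valid (s≤s z≤n) refl tt (λ _ → tt) ,
    λ x → trans (sym (addCycle-opposite x))
          (trans (addCycle-cong (fromℕ 0) (λ ()) x) (trans (cong (λ z → addCycle τ z x) last≡s) (sym (σ≗addCycle x))))
    where
    open RemoveCycle σ inv avoids s σ0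
    last≡s : fromℕ 0 ≡ s
    last≡s = toℕ-injective (sym (n<1⇒n≡0 (toℕ<n s)))
  encode (suc k) σ inv avoids | suc s = extendBy (encode k τ τ-involution τ-avoids)
    where
    open RemoveCycle σ inv avoids s σ0
    extendBy : Σ Code (λ c → Valid (double (suc k)) c × decode (double (suc k)) c ≗ τ) →
             Σ Code (λ c → Valid (double (suc (suc k))) c × decode (double (suc (suc k))) c ≗ σ)
    extendBy (c , v , decode≗τ) with c′ , v′ , decode≗ ← encode-addCycle s τ-decreasing c v decode≗τ =
      c′ , v′ , λ x → trans (decode≗ x) (sym (σ≗addCycle x))

module Polynomials where

  open Counting
  open import Data.Nat using (ℕ; zero; suc; _+_; _∸_; _≤_; _<_; _<?_; s≤s)
  open import Data.Nat.Properties using (+-suc; suc-injective; ≮⇒≥; <⇒≱; m≤m+n; m+[n∸m]≡n; +-cancelˡ-≡)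
  open import Data.List using (List)
  open import Data.List.Relation.Unary.All as All using (All)
  open import Data.Product using (Σ; _,_)
  open import Data.Sum using (_⊎_; inj₁; inj₂)
  open import Relation.Binary.PropositionalEquality using (_≡_; _≢_; refl; sym; trans; cong; subst)
  open import Relation.Nullary using (yes; no)

  substSq-even : ∀ e (p : Poly) → substSq p (e + e) ≡ p e
  substSq-even zero    p = refl
  substSq-even (suc e) p = trans (cong (substSq p) (cong suc (+-suc e e))) (substSq-even e (λ t → p (suc t)))

  substSq-odd : ∀ e (p : Poly) → substSq p (suc (e + e)) ≡ 0
  substSq-odd zero    p = refl
  substSq-odd (suc e) p = trans (cong (substSq p) (cong (λ z → suc (suc z)) (+-suc e e))) (substSq-odd e (λ t → p (suc t)))

  shiftBy-+ : ∀ e (p : Poly) d → shiftBy e p (e + d) ≡ p d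
  shiftBy-+ zero    p d = refl
  shiftBy-+ (suc e) p d = shiftBy-+ e p d

  shiftBy-< : ∀ e (p : Poly) d → d < e → shiftBy e p d ≡ 0
  shiftBy-< (suc e) p zero    _          = refl
  shiftBy-< (suc e) p (suc d) (s≤s d<e) = shiftBy-< e p d d<e

  shiftBy-cong : ∀ e {p r : Poly} → (∀ d → p d ≡ r d) → ∀ d → shiftBy e p d ≡ shiftBy e r d
  shiftBy-cong zero    p≗r d       = p≗r d
  shiftBy-cong (suc e) p≗r zero    = refl
  shiftBy-cong (suc e) p≗r (suc d) = shiftBy-cong e p≗r d

  private
    parity : ∀ d → Σ ℕ (λ e → (d ≡ e + e) ⊎ (d ≡ suc (e + e)))
    parity zero = 0 , inj₁ refl
    parity (suc d) with parity d
    ... | e , inj₁ refl = e , inj₂ refl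
    ... | e , inj₂ refl = suc e , inj₁ (cong suc (sym (+-suc e e)))

    double-injective : ∀ a b → a + a ≡ b + b → a ≡ b
    double-injective zero    zero    _    = refl
    double-injective (suc a) (suc b) same =
      cong suc (double-injective a b (suc-injective (trans (sym (+-suc a a)) (trans (suc-injective same) (+-suc b b)))))

    double≢odd : ∀ a b → a + a ≢ suc (b + b)
    double≢odd zero    b       ()
    double≢odd (suc a) zero    same with trans (sym (+-suc a a)) (suc-injective same)
    ... | ()
    double≢odd (suc a) (suc b) same =
      double≢odd a b (suc-injective (trans (sym (+-suc a a)) (trans (suc-injective same) (cong suc (+-suc b b)))))

    everywhere : ∀ {X : Set} {Q : X → Set} (xs : List X) → (∀ x → Q x) → All Q xs
    everywhere xs q = All.tabulate (λ {x} _ → q x)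

  substSq-genPoly : ∀ {X : Set} (L : List X) (w : X → ℕ) d → substSq (genPoly L w) d ≡ genPoly L (λ x → w x + w x) d
  substSq-genPoly L w d with parity d
  ... | e , inj₁ refl = trans (substSq-even e (genPoly L w))
        (count-cong _ _ L (everywhere L (λ x → (λ w≡e → cong (λ z → z + z) w≡e) , double-injective (w x) e)))
  ... | e , inj₂ refl = trans (substSq-odd e (genPoly L w)) (sym (count-none _ L (λ x → double≢odd (w x) e)))

  shiftBy-genPoly : ∀ {X : Set} (L : List X) (w : X → ℕ) e d → shiftBy e (genPoly L w) d ≡ genPoly L (λ x → e + w x) d
  shiftBy-genPoly L w e d with d <? e
  ... | yes d<e = trans (shiftBy-< e (genPoly L w) d d<e)
                        (sym (count-none _ L (λ x e+w≡d → <⇒≱ d<e (subst (e ≤_) e+w≡d (m≤m+n e (w x))))))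
  ... | no  d≮e = trans (cong (shiftBy e (genPoly L w)) (sym e+[d∸e]≡d)) (trans (shiftBy-+ e (genPoly L w) (d ∸ e))
                    (count-cong _ _ L (everywhere L (λ x → (λ w≡ → trans (cong (e +_) w≡) e+[d∸e]≡d) ,
                                                           (λ e+w≡ → +-cancelˡ-≡ e (w x) (d ∸ e) (trans e+w≡ (sym e+[d∸e]≡d)))))))
    where
    e+[d∸e]≡d : e + (d ∸ e) ≡ d
    e+[d∸e]≡d = m+[n∸m]≡n (≮⇒≥ d≮e)

-- The list of all valid codes of size 2k, assembled from the sets A and B.
module CodeEnumeration where

  open Counting
  open Sequences
  open Encoding
  open import Data.Nat using (ℕ; zero; suc; _+_; _*_; _∸_; _≤_; _<_; z≤n; s≤s)
  open import Data.Nat.Properties using (m∸n+n≡m; m+n∸n≡m; m≤n+m; suc-injective)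
  open import Data.Fin using (Fin; zero; suc)
  open import Data.List using (List; []; _∷_; _++_; map; concatMap; tabulate; reverse; length; upTo)
  open import Data.List.Properties using (length-reverse; length-tabulate; reverse-involutive; reverse-injective; tabulate-cong; ∷-injective)
  open import Data.List.Membership.Propositional using (_∈_; lose)
  open import Data.List.Membership.Propositional.Properties
    using (∈-map⁺; ∈-map⁻; ∈-filter⁻; ∈-concatMap⁺; ∈-concatMap⁻; ∈-upTo⁺; ∈-upTo⁻; ∈-++⁺ˡ; ∈-++⁺ʳ; ∈-++⁻)
  open import Data.List.Membership.Setoid.Properties using (∈-filter⁺)
  open import Data.List.Relation.Unary.Any using (Any; here; there)
  open import Data.List.Relation.Unary.Unique.Propositional using (Unique)
  import Data.List.Relation.Unary.Unique.Propositional.Properties as Uniqueₚ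
  import Data.List.Relation.Unary.Unique.Setoid.Properties as SetoidUniqueₚ
  import Data.List.Relation.Unary.All as All
  import Data.List.Relation.Unary.All.Properties as All
  import Data.List.Relation.Unary.AllPairs as AllPairs
  import Data.List.Relation.Unary.AllPairs.Properties as AllPairsₚ
  open import Data.Empty using (⊥)
  open import Data.Product using (Σ; _×_; _,_; proj₁; proj₂)
  open import Data.Sum using (inj₁; inj₂)
  open import Relation.Binary.PropositionalEquality using (_≡_; _≗_; refl; sym; trans; cong; subst; _→-setoid_) renaming (setoid to ≡-setoid)

  open FunctionEnumeration

  codeSize≡ : ∀ j rs → codeSize j rs ≡ double (length rs + j)
  codeSize≡ j []       = refl
  codeSize≡ j (r ∷ rs) = cong (λ z → suc (suc z)) (codeSize≡ j rs)

  inA-resp : ∀ m ℓ {f g : Fin ℓ → ℕ} → f ≗ g → InA m ℓ f → InA m ℓ g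
  inA-resp m ℓ {f} {g} f≗g f∈A = admissible⇒inA m ℓ g (subst (Admissible m) (tabulate-cong f≗g) (inA⇒admissible m ℓ f f∈A))

  inB-resp : ∀ m ℓ {f g : Fin ℓ → ℕ} → f ≗ g → InB m ℓ f → InB m ℓ g
  inB-resp m ℓ {f} {g} f≗g f∈B@(f∈A , _) =
    headNotOne⇒inB m ℓ g (inA-resp m ℓ f≗g f∈A) (subst HeadNotOne (tabulate-cong f≗g) (inB⇒headNotOne m ℓ f f∈B))

  candidate-complete : ∀ m ℓ (f : Fin ℓ → ℕ) → InA m ℓ f → f ∈ᶠ candidates m ℓ
  candidate-complete m ℓ f f∈A = allFuns-complete (upTo (suc (m + ℓ))) ℓ f (λ p → ∈-upTo⁺ (s≤s (inA-bound m ℓ f f∈A p)))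

  private
    fromList : ∀ ℓ (as : List ℕ) → length as ≡ ℓ → Σ (Fin ℓ → ℕ) λ f → tabulate f ≡ as
    fromList zero    []       _   = (λ ()) , refl
    fromList (suc ℓ) (a ∷ as) len with f , tab≡ ← fromList ℓ as (suc-injective len) =
      (λ { zero → a ; (suc p) → f p }) , cong (a ∷_) tab≡

    tabulate-injective : ∀ {ℓ} (f g : Fin ℓ → ℕ) → tabulate f ≡ tabulate g → f ≗ g
    tabulate-injective {suc ℓ} f g same zero    = proj₁ (∷-injective same)
    tabulate-injective {suc ℓ} f g same (suc p) = tabulate-injective (λ q → f (suc q)) (λ q → g (suc q)) (proj₂ (∷-injective same)) p

    witness : ∀ {X : Set} {P : X → Set} {xs : List X} → Any P xs → Σ X λ x → x ∈ xs × P x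
    witness (here px) = _ , here refl , px
    witness (there a) with x , x∈ , px ← witness a = x , there x∈ , px

  -- The codes of size 2k, listed by height J = 1, …, k: the reversal codes come
  -- from B_{2J+1,k-J}, the fixed codes from A_{2J,k-J} (sequences reversed).
  module Codes (k : ℕ) where

    fromB fromA : ∀ J → (Fin (k ∸ J) → ℕ) → Code
    fromB J a = code J reversal (reverse (tabulate a))
    fromA J a = code J fixed (reverse (tabulate a))

    codesOfHeight : ℕ → List Code
    codesOfHeight J = map (fromB J) (Bset (2 * J + 1) (k ∸ J)) ++ map (fromA J) (Aset (2 * J) (k ∸ J))

    allCodes : List Code
    allCodes = concatMap (λ j → codesOfHeight (suc j)) (upTo k)

    private
      size-fits : ∀ J (a : Fin (k ∸ J) → ℕ) → J ≤ k → double k ≡ codeSize J (reverse (tabulate a))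
      size-fits J a J≤k = trans (cong double (sym (m∸n+n≡m J≤k)))
        (trans (cong (λ z → double (z + J)) (sym (trans (length-reverse (tabulate a)) (length-tabulate a))))
               (sym (codeSize≡ J (reverse (tabulate a)))))

    allCodes-valid : ∀ {c} → c ∈ allCodes → Valid (double k) c
    allCodes-valid c∈
      with j , j∈ , c∈height ← witness (∈-concatMap⁻ (λ j → codesOfHeight (suc j)) {xs = upTo k} c∈)
      with ∈-++⁻ (map (fromB (suc j)) (Bset (2 * suc j + 1) (k ∸ suc j))) c∈height
    ... | inj₁ c∈B
      with a , a∈ , refl ← ∈-map⁻ (fromB (suc j)) c∈B
      with _ , a∈A , a₁≢1 ← ∈-filter⁻ (inB? (2 * suc j + 1) (k ∸ suc j)) {xs = candidates _ _} a∈ =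
      valid (s≤s z≤n) (size-fits (suc j) a (∈-upTo⁻ j∈)) (admissible⇒rev _ _ (inA⇒admissible _ _ a a∈A))
            (λ _ → headNotOne⇒last _ (inB⇒headNotOne _ _ a (a∈A , a₁≢1)))
    ... | inj₂ c∈A
      with a , a∈ , refl ← ∈-map⁻ (fromA (suc j)) c∈A
      with _ , a∈A ← ∈-filter⁻ (inA? (2 * suc j) (k ∸ suc j)) {xs = candidates _ _} a∈ =
      valid (s≤s z≤n) (size-fits (suc j) a (∈-upTo⁻ j∈)) (admissible⇒rev _ _ (inA⇒admissible _ _ a a∈A)) (λ ())

    valid⇒allCodes : ∀ c → Valid (double k) c → c ∈ allCodes
    valid⇒allCodes (code zero g rs) (valid () _ _ _)
    valid⇒allCodes (code (suc j) g rs) (valid _ size≡ adm noLast) =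
      ∈-concatMap⁺ (λ j → codesOfHeight (suc j)) {xs = upTo k} (lose (∈-upTo⁺ j<k) (inHeight g adm noLast))
      where
      J : ℕ
      J = suc j
      ℓ : ℕ
      ℓ = k ∸ J
      k≡ : k ≡ length rs + J
      k≡ = double-injective (trans size≡ (codeSize≡ J rs))
      j<k : j < k
      j<k = subst (J ≤_) (sym k≡) (m≤n+m J (length rs))
      length≡ : length (reverse rs) ≡ ℓ
      length≡ = trans (length-reverse rs) (sym (trans (cong (_∸ J) k≡) (m+n∸n≡m (length rs) J)))
      a : Fin ℓ → ℕ
      a = proj₁ (fromList ℓ (reverse rs) length≡)
      tabulate-a : tabulate a ≡ reverse rs
      tabulate-a = proj₂ (fromList ℓ (reverse rs) length≡)
      a∈A : ∀ m → AdmissibleRev m rs → InA m ℓ a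
      a∈A m adm = admissible⇒inA m ℓ a (subst (Admissible m) (sym tabulate-a)
        (rev⇒admissible m (reverse rs) (subst (AdmissibleRev m) (sym (reverse-involutive rs)) adm)))
      a∈B : ∀ m → AdmissibleRev m rs → LastNotOne rs → InB m ℓ a
      a∈B m adm lastNotOne = headNotOne⇒inB m ℓ a (a∈A m adm)
        (subst HeadNotOne (sym tabulate-a) (lastNotOne⇒head (reverse rs) (subst LastNotOne (sym (reverse-involutive rs)) lastNotOne)))
      -- the listed representative a′ ≗ a yields the same code
      same-code : ∀ {a′} → a ≗ a′ → reverse (tabulate a′) ≡ rs
      same-code a≗a′ = trans (cong reverse (trans (tabulate-cong (λ p → sym (a≗a′ p))) tabulate-a)) (reverse-involutive rs)
      inHeight : ∀ g → AdmissibleRev (startRun g J) rs → (g ≡ reversal → LastNotOne rs) → code J g rs ∈ codesOfHeight J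
      inHeight reversal adm noLast
        with a′ , a′∈ , a≗a′ ← witness (∈-filter⁺ (Fin ℓ →-setoid ℕ) (inB? (2 * J + 1) ℓ) (inB-resp (2 * J + 1) ℓ)
                                        (candidate-complete (2 * J + 1) ℓ a (a∈A _ adm)) (a∈B _ adm (noLast refl))) =
        ∈-++⁺ˡ (subst (_∈ map (fromB J) (Bset (2 * J + 1) ℓ)) (cong (code J reversal) (same-code a≗a′)) (∈-map⁺ (fromB J) a′∈))
      inHeight fixed adm _
        with a′ , a′∈ , a≗a′ ← witness (∈-filter⁺ (Fin ℓ →-setoid ℕ) (inA? (2 * J) ℓ) (inA-resp (2 * J) ℓ)
                                        (candidate-complete (2 * J) ℓ a (a∈A _ adm)) (a∈A _ adm)) =
        ∈-++⁺ʳ (map (fromB J) (Bset (2 * J + 1) ℓ))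
          (subst (_∈ map (fromA J) (Aset (2 * J) ℓ)) (cong (code J fixed) (same-code a≗a′)) (∈-map⁺ (fromA J) a′∈))

    private
      height-of : ∀ {J c} → c ∈ codesOfHeight J → Code.height c ≡ J
      height-of {J} c∈ with ∈-++⁻ (map (fromB J) (Bset (2 * J + 1) (k ∸ J))) c∈
      ... | inj₁ c∈B with _ , _ , refl ← ∈-map⁻ (fromB J) c∈B = refl
      ... | inj₂ c∈A with _ , _ , refl ← ∈-map⁻ (fromA J) c∈A = refl

      params-injective : ∀ J g (a a′ : Fin (k ∸ J) → ℕ) →
                         code J g (reverse (tabulate a)) ≡ code J g (reverse (tabulate a′)) → a ≗ a′
      params-injective J g a a′ same = tabulate-injective a a′ (reverse-injective (cong Code.params same))

      candidates-unique : ∀ m ℓ → Uniqueᶠ (candidates m ℓ)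
      candidates-unique m ℓ = allFuns-unique (upTo (suc (m + ℓ))) ℓ (Uniqueₚ.upTo⁺ (suc (m + ℓ)))

      codesOfHeight-unique : ∀ J → Unique (codesOfHeight J)
      codesOfHeight-unique J = Uniqueₚ.++⁺
        (SetoidUniqueₚ.map⁺ (Fin (k ∸ J) →-setoid ℕ) (≡-setoid Code) (params-injective J reversal _ _)
           (SetoidUniqueₚ.filter⁺ (Fin (k ∸ J) →-setoid ℕ) (inB? (2 * J + 1) (k ∸ J)) (candidates-unique (2 * J + 1) (k ∸ J))))
        (SetoidUniqueₚ.map⁺ (Fin (k ∸ J) →-setoid ℕ) (≡-setoid Code) (params-injective J fixed _ _)
           (SetoidUniqueₚ.filter⁺ (Fin (k ∸ J) →-setoid ℕ) (inA? (2 * J) (k ∸ J)) (candidates-unique (2 * J) (k ∸ J))))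
        λ (c∈B , c∈A) → reversal≢fixed (∈-map⁻ (fromB J) c∈B) (∈-map⁻ (fromA J) c∈A)
        where
        reversal≢fixed : ∀ {c} → Σ _ (λ a → _ × c ≡ fromB J a) → Σ _ (λ a → _ × c ≡ fromA J a) → ⊥
        reversal≢fixed (_ , _ , refl) (_ , _ , ())

    allCodes-unique : Unique allCodes
    allCodes-unique = Uniqueₚ.concat⁺ (All.map⁺ (All.tabulate (λ {j} _ → codesOfHeight-unique (suc j))))
      (AllPairsₚ.map⁺ (AllPairs.map (λ j≢j′ {c} c∈both → j≢j′ (suc-injective
                                       (trans (sym (height-of (proj₁ c∈both))) (height-of (proj₂ c∈both)))))
                                    (Uniqueₚ.upTo⁺ k)))

open import Data.Nat.Properties using (_≟_; +-identityʳ; +-commutativeSemigroup)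
open import Algebra.Properties.CommutativeSemigroup +-commutativeSemigroup using (interchange)
open import Data.Nat.Tactic.RingSolver using (solve-∀)
open import Data.Fin using (Fin)
open import Data.List using (List; []; _∷_; map; reverse; tabulate; upTo; allFin)
open import Data.List.Properties using (map-cong)
open import Data.List.Membership.Propositional using (_∈_)
open import Data.List.Membership.Propositional.Properties using (∈-filter⁻; ∈-allFin)
import Data.List.Membership.Setoid.Properties as SetoidMembershipₚ
open import Data.List.Relation.Unary.Unique.Propositional.Properties using (allFin⁺)
import Data.List.Relation.Unary.Unique.Setoid.Properties as SetoidUniqueₚ
open import Data.Nat.ListAction using (sum)
open import Data.Product using (Σ; _×_; _,_; proj₁; proj₂)
open import Relation.Binary.PropositionalEquality using (_≗_; refl; sym; trans; cong; cong₂; _→-setoid_; module ≡-Reasoning)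
open import Relation.Nullary using (Dec; ¬?)
open import Relation.Nullary.Decidable using (_×-dec_)

open Counting
open Involutions
open Coinversions
open Sequences
open Encoding
open Polynomials
open CodeEnumeration
open FunctionEnumeration

codeCoinv≡ : ∀ j g rs → codeCoinv (code j g rs) ≡ baseCoinv g j + (excess rs + excess rs)
codeCoinv≡ j g []       = sym (+-identityʳ (baseCoinv g j))
codeCoinv≡ j g (r ∷ rs) = trans (cong (λ z → (r ∸ 1) + ((r ∸ 1) + z)) (codeCoinv≡ j g rs))
                                (rearrange (r ∸ 1) (baseCoinv g j) (excess rs))
  where
  rearrange : ∀ a b e → a + (a + (b + (e + e))) ≡ b + ((a + e) + (a + e))
  rearrange = solve-∀

invPoly≡codeCount : ∀ k d → invPoly (double (suc k)) d ≡ count (λ c → codeCoinv c ≟ d) (Codes.allCodes (suc k))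
invPoly≡codeCount k d =
  trans (count-bijection (decode n) (λ σ → coinv σ ≟ d) coinv-resp (involutions123 n) allCodes
           (SetoidUniqueₚ.filter⁺ (Fin n →-setoid Fin n) inI? (allFuns-unique (allFin n) n (allFin⁺ n)))
           allCodes-unique decodes-into decodes-onto decode-injective′)
        (count-statistic (λ c → coinv (decode n c)) codeCoinv d allCodes (λ {c} c∈ → coinv-decode c (allCodes-valid c∈)))
  where
  open Codes (suc k)
  n : ℕ
  n = double (suc k)
  open DoubleCounting (Fin n →-setoid Fin n) using (count-bijection)
  inI? : ∀ (σ : Perm n) → Dec (IsInvolution σ × Avoids123 σ)
  inI? σ = inv? σ ×-dec ¬? (contains123? σ)
  inI-resp : ∀ {σ σ′ : Perm n} → σ ≗ σ′ → IsInvolution σ × Avoids123 σ → IsInvolution σ′ × Avoids123 σ′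
  inI-resp σ≗σ′ (inv , avoids) = involution-resp σ≗σ′ inv , avoids-resp σ≗σ′ avoids
  coinv-resp : ∀ {σ σ′ : Perm n} → σ ≗ σ′ → coinv σ ≡ d → coinv σ′ ≡ d
  coinv-resp {σ} {σ′} σ≗σ′ coinv≡d =
    trans (coinv≡coinvSum σ′) (trans (sym (coinvSum-cong σ≗σ′)) (trans (sym (coinv≡coinvSum σ)) coinv≡d))
  coinv-decode : ∀ c → Valid n c → coinv (decode n c) ≡ codeCoinv c
  coinv-decode (code j g rs) v = trans (coinv≡coinvSum (decode n (code j g rs))) (Sound.coinvSum≡ (sound j g rs v))
  decodes-into : ∀ {c} → c ∈ allCodes → decode n c ∈ᶠ involutions123 n
  decodes-into {code j g rs} c∈ =
    SetoidMembershipₚ.∈-filter⁺ (Fin n →-setoid Fin n) inI? inI-resp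
      (allFuns-complete (allFin n) n (decode n (code j g rs)) (λ p → ∈-allFin _))
      (Sound.involution sound-c , Sound.avoids sound-c)
    where sound-c = sound j g rs (allCodes-valid c∈)
  decodes-onto : ∀ {σ} → σ ∈ᶠ involutions123 n → Σ Code λ c → c ∈ allCodes × σ ≗ decode n c
  decodes-onto {σ} σ∈ with _ , (inv , avoids) ← SetoidMembershipₚ.∈-filter⁻ (Fin n →-setoid Fin n) inI? inI-resp {xs = allFuns (allFin n) n} σ∈
                      with c , v , decode≗σ ← encode k σ inv avoids =
    c , valid⇒allCodes c v , λ p → sym (decode≗σ p)
  decode-injective′ : ∀ {c c′} → c ∈ allCodes → c′ ∈ allCodes → decode n c ≗ decode n c′ → c ≡ c′
  decode-injective′ c∈ c′∈ = decode-injective n _ _ (allCodes-valid c∈) (allCodes-valid c′∈)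

private
  sum-map-+ : ∀ (f g : ℕ → ℕ) xs → sum (map (λ x → f x + g x) xs) ≡ sum (map f xs) + sum (map g xs)
  sum-map-+ f g []       = refl
  sum-map-+ f g (x ∷ xs) =
    trans (cong ((f x + g x) +_) (sum-map-+ f g xs)) (interchange (f x) (g x) (sum (map f xs)) (sum (map g xs)))

  sum-map-cong : ∀ {f g : ℕ → ℕ} → (∀ x → f x ≡ g x) → ∀ xs → sum (map f xs) ≡ sum (map g xs)
  sum-map-cong f≗g xs = cong sum (map-cong f≗g xs)

module _ (k d : ℕ) where
  open Codes k

  private
    A-positive : ∀ {m ℓ a} → a ∈ Aset m ℓ → ∀ p → 1 ≤ a p
    A-positive {m} {ℓ} a∈ = InA.positive (proj₂ (∈-filter⁻ (inA? m ℓ) {xs = candidates m ℓ} a∈))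

    B-positive : ∀ {m ℓ a} → a ∈ Bset m ℓ → ∀ p → 1 ≤ a p
    B-positive {m} {ℓ} a∈ = InA.positive (proj₁ (proj₂ (∈-filter⁻ (inB? m ℓ) {xs = candidates m ℓ} a∈)))

    B-term : ∀ J → substSq (Bpoly (2 * J + 1) (k ∸ J)) d ≡ count (λ c → codeCoinv c ≟ d) (map (fromB J) (Bset (2 * J + 1) (k ∸ J)))
    B-term J = trans (substSq-genPoly (Bset m ℓ) weight d)
      (trans (count-statistic _ (λ a → codeCoinv (fromB J a)) d (Bset m ℓ) (λ {a} a∈ → sym (coinv-fromB a a∈)))
             (sym (count-map (λ c → codeCoinv c ≟ d) (fromB J) (Bset m ℓ))))
      where
      m ℓ : ℕ
      m = 2 * J + 1
      ℓ = k ∸ J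
      coinv-fromB : ∀ a → a ∈ Bset m ℓ → codeCoinv (fromB J a) ≡ weight a + weight a
      coinv-fromB a a∈ = trans (codeCoinv≡ J reversal (reverse (tabulate a)))
        (cong (λ w → w + w) (sym (weight≡excess ℓ a (B-positive a∈))))

    A-term : ∀ J → shiftBy (2 * J ∸ 1) (substSq (Apoly (2 * J) (k ∸ J))) d
                   ≡ count (λ c → codeCoinv c ≟ d) (map (fromA J) (Aset (2 * J) (k ∸ J)))
    A-term J = trans (shiftBy-cong e (substSq-genPoly (Aset m ℓ) weight) d)
      (trans (shiftBy-genPoly (Aset m ℓ) (λ a → weight a + weight a) e d)
      (trans (count-statistic _ (λ a → codeCoinv (fromA J a)) d (Aset m ℓ) (λ {a} a∈ → sym (coinv-fromA a a∈)))
             (sym (count-map (λ c → codeCoinv c ≟ d) (fromA J) (Aset m ℓ)))))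
      where
      m ℓ e : ℕ
      m = 2 * J
      ℓ = k ∸ J
      e = 2 * J ∸ 1
      coinv-fromA : ∀ a → a ∈ Aset m ℓ → codeCoinv (fromA J a) ≡ e + (weight a + weight a)
      coinv-fromA a a∈ = trans (codeCoinv≡ J fixed (reverse (tabulate a)))
        (cong (λ w → e + (w + w)) (sym (weight≡excess ℓ a (A-positive a∈))))

  rhs≡codeCount : (sumPoly (λ j → substSq (Bpoly (2 * j + 1) (k ∸ j))) k
                   ⊕ sumPoly (λ j → shiftBy (2 * j ∸ 1) (substSq (Apoly (2 * j) (k ∸ j)))) k) d
                  ≡ count (λ c → codeCoinv c ≟ d) allCodes
  rhs≡codeCount = begin
    sum (map (λ j → B (suc j)) (upTo k)) + sum (map (λ j → A (suc j)) (upTo k))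
      ≡⟨ cong₂ _+_ (sum-map-cong (λ j → B-term (suc j)) (upTo k)) (sum-map-cong (λ j → A-term (suc j)) (upTo k)) ⟩
    sum (map (λ j → countOf (Bcodes (suc j))) (upTo k)) + sum (map (λ j → countOf (Acodes (suc j))) (upTo k))
      ≡⟨ sum-map-+ (λ j → countOf (Bcodes (suc j))) (λ j → countOf (Acodes (suc j))) (upTo k) ⟨
    sum (map (λ j → countOf (Bcodes (suc j)) + countOf (Acodes (suc j))) (upTo k))
      ≡⟨ sum-map-cong (λ j → count-++ (λ c → codeCoinv c ≟ d) (Bcodes (suc j)) (Acodes (suc j))) (upTo k) ⟨
    sum (map (λ j → countOf (codesOfHeight (suc j))) (upTo k))
      ≡⟨ count-concatMap (λ c → codeCoinv c ≟ d) (λ j → codesOfHeight (suc j)) (upTo k) ⟨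
    countOf allCodes ∎
    where
    open ≡-Reasoning
    B A : ℕ → ℕ
    B j = substSq (Bpoly (2 * j + 1) (k ∸ j)) d
    A j = shiftBy (2 * j ∸ 1) (substSq (Apoly (2 * j) (k ∸ j))) d
    Bcodes Acodes : ℕ → List Code
    Bcodes J = map (fromB J) (Bset (2 * J + 1) (k ∸ J))
    Acodes J = map (fromA J) (Aset (2 * J) (k ∸ J))
    countOf : List Code → ℕ
    countOf = count (λ c → codeCoinv c ≟ d)

theorem3p21 : ∀ (k : ℕ) → 1 ≤ k → ∀ (d : ℕ) →
  invPoly (2 * k) d
    ≡ (sumPoly (λ j → substSq (Bpoly (2 * j + 1) (k ∸ j))) k
       ⊕ sumPoly (λ j → shiftBy (2 * j ∸ 1) (substSq (Apoly (2 * j) (k ∸ j)))) k) d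
theorem3p21 (suc k) _ d = begin
  invPoly (2 * suc k) d                                       ≡⟨ cong (λ n → invPoly n d) (double≡2* (suc k)) ⟨
  invPoly (double (suc k)) d                                  ≡⟨ invPoly≡codeCount k d ⟩
  count (λ c → codeCoinv c ≟ d) (Codes.allCodes (suc k))      ≡⟨ rhs≡codeCount (suc k) d ⟨
  _                                                           ∎
  where open ≡-Reasoning
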